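{- Let $k\geq 2$ and let $G_1\oplus_k G_2$ be a $k$-clique-sum of graphs $G_1$ and $G_2$. Then $$meg(G_1)+meg(G_2)-2k\leq meg(G_1\oplus_k G_2)\leq meg(G_1)+meg(G_2).$$ Moreover, both bounds are tight: for every $k\geq 2$ there exist graphs $G_1,G_2$ and a $k$-clique-sum attaining equality in the lower bound, and there exist graphs $G_1,G_2$ and a $k$-clique-sum attaining equality in the upper bound.
   Context: All graphs are finite and simple. If $G_1$ and $G_2$ contain cliques $C_1$ and $C_2$ of size $k$, a $k$-clique-sum $G_1\oplus_k G_2$ is the graph obtained from the disjoint union of $G_1$ and $G_2$ by identifying each vertex of $C_1$ with exactly one vertex of $C_2$ (bijectively); no edges are deleted (the identified clique edges are merged, giving a simple graph). A pair of vertices $u,v$ (or any vertex set containing them) monitors an edge $e$ if $e$ lies on every shortest $u$–$v$ path. A monitoring edge-geodetic set (MEG-set) of $G$ is a set $M\subseteq V(G)$ such that every edge of $G$ is monitored by some pair of vertices of $M$; $meg(G)$ is the minimum size of an MEG-set. -}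

module Defs where

open import Data.Nat using (ℕ; zero; suc; _+_; _≤_)
open import Data.Bool using (Bool; true; false)
open import Data.Fin using (Fin)
open import Data.Fin.Subset using (Subset; _∈_; ∣_∣)
open import Data.Product using (Σ; ∃; ∃-syntax; _×_; _,_)
open import Data.Sum using (_⊎_)
open import Relation.Binary.PropositionalEquality using (_≡_; _≢_)
open import Function.Bundles using (_⇔_)

record Graph : Set where
  field
    n       : ℕ
    adj     : Fin n → Fin n → Bool
    adj-sym : ∀ x y → adj x y ≡ adj y x
    adj-irr : ∀ x → adj x x ≡ false

open Graph public

Vertex : Graph → Set
Vertex G = Fin (n G)

data Walk (G : Graph) : Vertex G → Vertex G → Set where
  []  : ∀ {u} → Walk G u u
  _∷_ : ∀ {u w v} → adj G u w ≡ true → Walk G w v → Walk G u v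

infixr 5 _∷_

walkLength : ∀ {G u v} → Walk G u v → ℕ
walkLength []      = 0
walkLength (_ ∷ p) = suc (walkLength p)

-- p is a shortest u–v path: no u–v walk is shorter
-- (a shortest walk is necessarily a path).
IsShortest : ∀ {G u v} → Walk G u v → Set
IsShortest {G} {u} {v} p = ∀ (q : Walk G u v) → walkLength p ≤ walkLength q

data EdgeOn {G : Graph} (x y : Vertex G) : ∀ {u v} → Walk G u v → Set where
  here-xy : ∀ {v} (e : adj G x y ≡ true) (p : Walk G y v) → EdgeOn x y (e ∷ p)
  here-yx : ∀ {v} (e : adj G y x ≡ true) (p : Walk G x v) → EdgeOn x y (e ∷ p)
  there   : ∀ {u w v} (e : adj G u w ≡ true) {p : Walk G w v} →
            EdgeOn x y p → EdgeOn x y (e ∷ p)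

Monitors : (G : Graph) → Vertex G → Vertex G → Vertex G → Vertex G → Set
Monitors G u v x y = ∀ (p : Walk G u v) → IsShortest p → EdgeOn x y p

IsMEGSet : (G : Graph) → Subset (n G) → Set
IsMEGSet G M = ∀ x y → adj G x y ≡ true →
  ∃[ u ] ∃[ v ] (u ∈ M × v ∈ M × Monitors G u v x y)

IsMeg : Graph → ℕ → Set
IsMeg G m = (∃[ M ] (IsMEGSet G M × ∣ M ∣ ≡ m))
          × (∀ M → IsMEGSet G M → m ≤ ∣ M ∣)

Connected : Graph → Set
Connected G = ∀ (u v : Vertex G) → Walk G u v

-- G is (isomorphic to) a k-clique-sum of G₁ and G₂: G₁ and G₂ embed into G
-- via f₁, f₂, jointly covering V(G), overlapping exactly on the identified
-- k-cliques C₁ i ~ C₂ i, and E(G) is the union of the images of E(G₁), E(G₂).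
record IsCliqueSum (k : ℕ) (G₁ G₂ G : Graph) : Set where
  field
    C₁      : Fin k → Vertex G₁
    C₂      : Fin k → Vertex G₂
    C₁-inj  : ∀ i j → C₁ i ≡ C₁ j → i ≡ j
    C₂-inj  : ∀ i j → C₂ i ≡ C₂ j → i ≡ j
    C₁-cl   : ∀ i j → i ≢ j → adj G₁ (C₁ i) (C₁ j) ≡ true
    C₂-cl   : ∀ i j → i ≢ j → adj G₂ (C₂ i) (C₂ j) ≡ true
    f₁      : Vertex G₁ → Vertex G
    f₂      : Vertex G₂ → Vertex G
    f₁-inj  : ∀ a a' → f₁ a ≡ f₁ a' → a ≡ a'
    f₂-inj  : ∀ b b' → f₂ b ≡ f₂ b' → b ≡ b'
    cover   : ∀ z → (∃[ a ] f₁ a ≡ z) ⊎ (∃[ b ] f₂ b ≡ z)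
    glue    : ∀ a b → (f₁ a ≡ f₂ b) ⇔ (∃[ i ] (a ≡ C₁ i × b ≡ C₂ i))
    edges   : ∀ z w → (adj G z w ≡ true) ⇔
                ((∃[ a ] ∃[ a' ] (f₁ a ≡ z × f₁ a' ≡ w × adj G₁ a a' ≡ true))
                 ⊎ (∃[ b ] ∃[ b' ] (f₂ b ≡ z × f₂ b' ≡ w × adj G₂ b b' ≡ true)))

{-# OPTIONS --safe #-}
-- Upper bound: the images of MEG-sets of G₁ and G₂ together form an MEG-set of G. A shortest
-- walk of G between two vertices of G₁ projects into G₁ without getting longer, because an
-- excursion into G₂ leaves and re-enters G₁ through the clique and can be replaced by a single
-- clique edge; hence a pair of G₁ monitors the same edges in G₁ and in G.
-- Lower bound: if M is an MEG-set of G, then (M ∩ V(G₁)) ∪ C₁ is an MEG-set of G₁, since a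
-- monitoring pair outside G₁ can be moved to the clique vertex through which its geodesics
-- enter G₁. The parts of M off the clique on the two sides are disjoint, so
-- m₁ + m₂ ≤ (|M₁| + k) + (|M₂| + k) ≤ |M| + 2k.
-- Tightness: a vertex x with a neighbour y lies in every MEG-set when every other neighbour of
-- x reaches y within two steps avoiding x. Gluing two copies of a graph all of whose 2k + 1
-- vertices are forced in this way, with two clique vertices exchanged, leaves 2k + 2 outer
-- vertices that monitor every edge of the sum; gluing two suns, whose k leaves are forced and
-- monitor everything, attains the upper bound.

module Submission where

open import Defs
open import Data.Nat using (ℕ; zero; suc; _+_; _*_; _≤_; _<_; z≤n; s≤s)
open import Data.Nat.Properties
  using ( +-comm; +-identityʳ; +-suc; suc-injective; m≤m+n; m≤n+m; ≤-trans; ≤-reflexive; ≤-antisym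
        ; ≤∧≢⇒<; <⇒≱; n≤1+n; m≤n⇒m≤1+n; +-mono-≤; +-monoʳ-≤; +-monoˡ-≤; +-cancelʳ-≤; module ≤-Reasoning )
open import Data.Nat.Tactic.RingSolver using (solve-∀)
open import Data.Bool using (Bool; true; false; not)
import Data.Bool.Properties as Bool
open import Data.Fin using (Fin; zero; suc; splitAt; join; fromℕ<)
open import Data.Fin.Properties using (_≟_; any?; splitAt-join; join-splitAt)
import Data.Fin.Properties as Fin
open import Data.Fin.Subset using (Subset; _∈_; ∣_∣; _∪_; _-_; ⊤; _⊆_; inside; outside)
open import Data.Fin.Subset.Properties
  using (_∈?_; ∈⊤; ∣⊤∣≡n; x∈p∪q⁺; x∈p∪q⁻; p⊆q⇒∣p∣≤∣q∣; x∈p∧x≢y⇒x∈p-y; x∈p⇒∣p-x∣<∣p∣)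
open import Data.Product using (Σ; ∃; ∃-syntax; _×_; _,_; proj₁; proj₂)
open import Data.Sum using (_⊎_; inj₁; inj₂; map₁)
import Data.Sum as Sum
open import Data.Sum.Properties using (inj₁-injective; inj₂-injective)
open import Data.Empty using (⊥; ⊥-elim)
open import Function using (_∘_; case_of_)
open import Function.Bundles using (Equivalence; mk⇔)
open import Relation.Nullary using (¬_; Dec; yes; no; does)
open import Relation.Nullary.Decidable using (_×-dec_; _⊎-dec_; ¬?; dec-true; dec-false; does-⇔)
open import Relation.Unary using (Decidable)
open import Relation.Binary.PropositionalEquality

open Equivalence using (to; from)

-- Walks and monitoring

adj-flip : ∀ G {u w} → adj G u w ≡ true → adj G w u ≡ true
adj-flip G {u} {w} e = trans (adj-sym G w u) e

adj⇒≢ : ∀ G {x y} → adj G x y ≡ true → x ≢ y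
adj⇒≢ G {x} e refl with trans (sym (adj-irr G x)) e
... | ()

module _ {G : Graph} where

  infixr 5 _++_

  _++_ : ∀ {u v w} → Walk G u v → Walk G v w → Walk G u w
  []      ++ q = q
  (e ∷ p) ++ q = e ∷ (p ++ q)

  reverse : ∀ {u v} → Walk G u v → Walk G v u
  reverse []      = []
  reverse (e ∷ p) = reverse p ++ (adj-flip G e ∷ [])

  walkLength-++ : ∀ {u v w} (p : Walk G u v) (q : Walk G v w) →
                  walkLength (p ++ q) ≡ walkLength p + walkLength q
  walkLength-++ []      q = refl
  walkLength-++ (e ∷ p) q = cong suc (walkLength-++ p q)

  walkLength-reverse : ∀ {u v} (p : Walk G u v) → walkLength (reverse p) ≡ walkLength p
  walkLength-reverse []      = refl
  walkLength-reverse (e ∷ p) = begin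
    walkLength (reverse p ++ _)  ≡⟨ walkLength-++ (reverse p) _ ⟩
    walkLength (reverse p) + 1   ≡⟨ +-comm _ 1 ⟩
    suc (walkLength (reverse p)) ≡⟨ cong suc (walkLength-reverse p) ⟩
    suc (walkLength p)           ∎
    where open ≡-Reasoning

  walkOfLength? : ∀ ℓ u v → Dec (Σ (Walk G u v) λ q → walkLength q ≡ ℓ)
  walkOfLength? zero u v with u ≟ v
  ... | yes refl = yes ([] , refl)
  ... | no u≢v   = no λ { ([] , _) → u≢v refl ; (_ ∷ _ , ()) }
  walkOfLength? (suc ℓ) u v
    with any? (λ w → (adj G u w Bool.≟ true) ×-dec walkOfLength? ℓ w v)
  ... | yes (w , e , q , |q|≡ℓ) = yes (e ∷ q , cong suc |q|≡ℓ)
  ... | no ∄w = no λ { ([] , ())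
                     ; (_∷_ {w = w} e q , |q|≡ℓ) → ∄w (w , e , q , suc-injective |q|≡ℓ) }

  private
    shortestAbove : ∀ {u v} d r → (∀ (q : Walk G u v) → d ≤ walkLength q) →
                    (p : Walk G u v) → walkLength p ≡ d + r → Σ (Walk G u v) IsShortest
    shortestAbove {u} {v} d r d≤ p |p|≡ with walkOfLength? d u v
    ... | yes (q , |q|≡d) = q , λ q′ → subst (_≤ walkLength q′) (sym |q|≡d) (d≤ q′)
    shortestAbove d zero    d≤ p |p|≡ | no ∄q = ⊥-elim (∄q (p , trans |p|≡ (+-identityʳ d)))
    shortestAbove d (suc r) d≤ p |p|≡ | no ∄q =
      shortestAbove (suc d) r (λ q → ≤∧≢⇒< (d≤ q) λ d≡ → ∄q (q , sym d≡)) p (trans |p|≡ (+-suc d r))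

  shortest : ∀ {u v} → Walk G u v → Σ (Walk G u v) IsShortest
  shortest p = shortestAbove 0 (walkLength p) (λ _ → z≤n) p refl

  shorter-than-shortest : ∀ {u v} {p : Walk G u v} → IsShortest p →
                          (q : Walk G u v) → ¬ (walkLength q < walkLength p)
  shorter-than-shortest sh q q<p = <⇒≱ q<p (sh q)

  EdgeOn-∷⁻ : ∀ {x y u w v} {e : adj G u w ≡ true} {p : Walk G w v} →
              EdgeOn x y (e ∷ p) → (u ≡ x × w ≡ y) ⊎ (u ≡ y × w ≡ x) ⊎ EdgeOn x y p
  EdgeOn-∷⁻ (here-xy e p) = inj₁ (refl , refl)
  EdgeOn-∷⁻ (here-yx e p) = inj₂ (inj₁ (refl , refl))
  EdgeOn-∷⁻ (there e h)   = inj₂ (inj₂ h)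

  EdgeOn-head : ∀ {x y u w v} (e : adj G u w ≡ true) (p : Walk G w v) →
                (u ≡ x × w ≡ y) ⊎ (u ≡ y × w ≡ x) → EdgeOn x y (e ∷ p)
  EdgeOn-head e p (inj₁ (refl , refl)) = here-xy e p
  EdgeOn-head e p (inj₂ (refl , refl)) = here-yx e p

  EdgeOn-swap : ∀ {x y u v} {p : Walk G u v} → EdgeOn x y p → EdgeOn y x p
  EdgeOn-swap (here-xy e p) = here-yx e p
  EdgeOn-swap (here-yx e p) = here-xy e p
  EdgeOn-swap (there e h)   = there e (EdgeOn-swap h)

  EdgeOn-++⁻ : ∀ {x y u v w} (p : Walk G u v) {q : Walk G v w} →
               EdgeOn x y (p ++ q) → EdgeOn x y p ⊎ EdgeOn x y q
  EdgeOn-++⁻ []      h = inj₂ h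
  EdgeOn-++⁻ (e ∷ p) h with EdgeOn-∷⁻ h
  ... | inj₁ ends        = inj₁ (EdgeOn-head e p (inj₁ ends))
  ... | inj₂ (inj₁ ends) = inj₁ (EdgeOn-head e p (inj₂ ends))
  ... | inj₂ (inj₂ h′) with EdgeOn-++⁻ p h′
  ...   | inj₁ h″ = inj₁ (there e h″)
  ...   | inj₂ h″ = inj₂ h″

  EdgeOn-reverse⁻ : ∀ {x y u v} (p : Walk G u v) → EdgeOn x y (reverse p) → EdgeOn x y p
  EdgeOn-reverse⁻ (e ∷ p) h with EdgeOn-++⁻ (reverse p) h
  ... | inj₁ h′ = there e (EdgeOn-reverse⁻ p h′)
  ... | inj₂ h′ with EdgeOn-∷⁻ h′
  ...   | inj₁ (refl , refl)        = here-yx e p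
  ...   | inj₂ (inj₁ (refl , refl)) = here-xy e p

  monitors-reverse : ∀ {u v x y} → Monitors G u v x y → Monitors G v u x y
  monitors-reverse mon p sh = EdgeOn-reverse⁻ p (mon (reverse p) λ q →
    subst₂ _≤_ (sym (walkLength-reverse p)) (walkLength-reverse q) (sh (reverse q)))

  monitors-swap : ∀ {u v x y} → Monitors G u v x y → Monitors G u v y x
  monitors-swap mon p sh = EdgeOn-swap (mon p sh)

  adjacent-monitors : ∀ {x y} → adj G x y ≡ true → Monitors G x y x y
  adjacent-monitors e []             sh = ⊥-elim (adj⇒≢ G e refl)
  adjacent-monitors e (e′ ∷ [])      sh = here-xy e′ []
  adjacent-monitors e (_ ∷ _ ∷ _)    sh with sh (e ∷ [])
  ... | s≤s ()

  monitors-suffix : ∀ {u w v x y} → Monitors G u v x y →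
                    (p₁ : Walk G u w) (p₂ : Walk G w v) → IsShortest (p₁ ++ p₂) →
                    ¬ EdgeOn x y p₁ → Monitors G w v x y
  monitors-suffix mon p₁ p₂ sh xy∉p₁ q shq with EdgeOn-++⁻ p₁ (mon (p₁ ++ q) sh′)
    where
      sh′ : IsShortest (p₁ ++ q)
      sh′ r = begin
        walkLength (p₁ ++ q)            ≡⟨ walkLength-++ p₁ q ⟩
        walkLength p₁ + walkLength q    ≤⟨ +-monoʳ-≤ (walkLength p₁) (shq p₂) ⟩
        walkLength p₁ + walkLength p₂   ≡⟨ walkLength-++ p₁ p₂ ⟨
        walkLength (p₁ ++ p₂)           ≤⟨ sh r ⟩
        walkLength r                    ∎
        where open ≤-Reasoning
  ... | inj₁ h = ⊥-elim (xy∉p₁ h)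
  ... | inj₂ h = h

MonitoredBy : (G : Graph) → Subset (n G) → Vertex G → Vertex G → Set
MonitoredBy G M x y = ∃ λ u → ∃ λ v → u ∈ M × v ∈ M × Monitors G u v x y

MonitoredBy-swap : ∀ {G M x y} → MonitoredBy G M x y → MonitoredBy G M y x
MonitoredBy-swap (u , v , u∈ , v∈ , mon) = u , v , u∈ , v∈ , monitors-swap mon

-- Counting subsets

module SubsetCounting where
  open import Data.Vec using ([]; _∷_; here; there)

  subsetOf : ∀ {n} {P : Fin n → Set} → Decidable P → Subset n
  subsetOf {zero}  P? = []
  subsetOf {suc n} P? = does (P? zero) ∷ subsetOf (λ i → P? (suc i))

  ∈-subsetOf⁺ : ∀ {n} {P : Fin n → Set} (P? : Decidable P) {x} → P x → x ∈ subsetOf P?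
  ∈-subsetOf⁺ P? {zero} px with P? zero
  ... | yes _  = here
  ... | no ¬px = ⊥-elim (¬px px)
  ∈-subsetOf⁺ P? {suc x} px = there (∈-subsetOf⁺ (λ i → P? (suc i)) px)

  ∈-subsetOf⁻ : ∀ {n} {P : Fin n → Set} (P? : Decidable P) {x} → x ∈ subsetOf P? → P x
  ∈-subsetOf⁻ P? {zero} x∈ with P? zero | x∈
  ... | yes px | _  = px
  ... | no _   | ()
  ∈-subsetOf⁻ P? {suc x} (there x∈) = ∈-subsetOf⁻ (λ i → P? (suc i)) x∈

  injection⇒∣p∣≤∣q∣ : ∀ {m n} (p : Subset m) (q : Subset n) (f : ∀ a → a ∈ p → Fin n) →
                      (∀ a a∈p → f a a∈p ∈ q) →
                      (∀ a b a∈p b∈p → f a a∈p ≡ f b b∈p → a ≡ b) → ∣ p ∣ ≤ ∣ q ∣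
  injection⇒∣p∣≤∣q∣ []            q f f∈q f-inj = z≤n
  injection⇒∣p∣≤∣q∣ (outside ∷ p) q f f∈q f-inj =
    injection⇒∣p∣≤∣q∣ p q (λ a a∈p → f (suc a) (there a∈p)) (λ a a∈p → f∈q (suc a) (there a∈p))
      (λ a b a∈p b∈p eq → Fin.suc-injective (f-inj (suc a) (suc b) (there a∈p) (there b∈p) eq))
  injection⇒∣p∣≤∣q∣ (inside ∷ p) q f f∈q f-inj =
    ≤-trans (s≤s ∣p∣≤∣q-f0∣) (x∈p⇒∣p-x∣<∣p∣ (f∈q zero here))
    where
      ∣p∣≤∣q-f0∣ : ∣ p ∣ ≤ ∣ q - f zero here ∣
      ∣p∣≤∣q-f0∣ = injection⇒∣p∣≤∣q∣ p (q - f zero here) (λ a a∈p → f (suc a) (there a∈p))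
        (λ a a∈p → x∈p∧x≢y⇒x∈p-y (f∈q (suc a) (there a∈p))
                     (λ eq → Fin.0≢1+n (f-inj zero (suc a) here (there a∈p) (sym eq))))
        (λ a b a∈p b∈p eq → Fin.suc-injective (f-inj (suc a) (suc b) (there a∈p) (there b∈p) eq))

  ∣p∪q∣≤∣p∣+∣q∣ : ∀ {n} (p q : Subset n) → ∣ p ∪ q ∣ ≤ ∣ p ∣ + ∣ q ∣
  ∣p∪q∣≤∣p∣+∣q∣ []            []            = z≤n
  ∣p∪q∣≤∣p∣+∣q∣ (inside ∷ p)  (inside ∷ q)  = s≤s (≤-trans (∣p∪q∣≤∣p∣+∣q∣ p q) (≤-trans (m≤n+m _ 1) (≤-reflexive (sym (+-suc _ _)))))
  ∣p∪q∣≤∣p∣+∣q∣ (inside ∷ p)  (outside ∷ q) = s≤s (∣p∪q∣≤∣p∣+∣q∣ p q)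
  ∣p∪q∣≤∣p∣+∣q∣ (outside ∷ p) (inside ∷ q)  = ≤-trans (s≤s (∣p∪q∣≤∣p∣+∣q∣ p q)) (≤-reflexive (sym (+-suc _ _)))
  ∣p∪q∣≤∣p∣+∣q∣ (outside ∷ p) (outside ∷ q) = ∣p∪q∣≤∣p∣+∣q∣ p q

  disjoint⇒∣p∣+∣q∣≤∣p∪q∣ : ∀ {n} (p q : Subset n) → (∀ x → x ∈ p → x ∈ q → ⊥) → ∣ p ∣ + ∣ q ∣ ≤ ∣ p ∪ q ∣
  disjoint⇒∣p∣+∣q∣≤∣p∪q∣ []            []            _ = z≤n
  disjoint⇒∣p∣+∣q∣≤∣p∪q∣ (inside ∷ p)  (inside ∷ q)  disj = ⊥-elim (disj zero here here)
  disjoint⇒∣p∣+∣q∣≤∣p∪q∣ (inside ∷ p)  (outside ∷ q) disj =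
    s≤s (disjoint⇒∣p∣+∣q∣≤∣p∪q∣ p q λ x x∈p x∈q → disj (suc x) (there x∈p) (there x∈q))
  disjoint⇒∣p∣+∣q∣≤∣p∪q∣ (outside ∷ p) (inside ∷ q)  disj = ≤-trans (≤-reflexive (+-suc _ _))
    (s≤s (disjoint⇒∣p∣+∣q∣≤∣p∪q∣ p q λ x x∈p x∈q → disj (suc x) (there x∈p) (there x∈q)))
  disjoint⇒∣p∣+∣q∣≤∣p∪q∣ (outside ∷ p) (outside ∷ q) disj =
    disjoint⇒∣p∣+∣q∣≤∣p∪q∣ p q λ x x∈p x∈q → disj (suc x) (there x∈p) (there x∈q)

  module _ {m n} (f : Fin m → Fin n) where

    -- opaque: comparing two unfolded images would evaluate subsetOf over every vertex
    opaque
      image : Subset m → Subset n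
      image p = subsetOf λ z → any? λ a → (a ∈? p) ×-dec (f a ≟ z)

      ∈-image⁺ : ∀ {p a} → a ∈ p → f a ∈ image p
      ∈-image⁺ {a = a} a∈p = ∈-subsetOf⁺ _ (a , a∈p , refl)

      ∈-image⁻ : ∀ {p z} → z ∈ image p → ∃ λ a → a ∈ p × f a ≡ z
      ∈-image⁻ = ∈-subsetOf⁻ _

    ∣image∣≤∣p∣ : ∀ p → ∣ image p ∣ ≤ ∣ p ∣
    ∣image∣≤∣p∣ p = injection⇒∣p∣≤∣q∣ (image p) p (λ z z∈ → proj₁ (∈-image⁻ z∈))
      (λ z z∈ → proj₁ (proj₂ (∈-image⁻ z∈)))
      (λ z z′ z∈ z′∈ eq → trans (sym (proj₂ (proj₂ (∈-image⁻ z∈))))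
                            (trans (cong f eq) (proj₂ (proj₂ (∈-image⁻ z′∈)))))

    injective⇒∣p∣≤∣image∣ : (∀ a b → f a ≡ f b → a ≡ b) → ∀ p → ∣ p ∣ ≤ ∣ image p ∣
    injective⇒∣p∣≤∣image∣ f-inj p =
      injection⇒∣p∣≤∣q∣ p (image p) (λ a _ → f a) (λ a → ∈-image⁺) (λ a b _ _ → f-inj a b)

    injective⇒∣image∣≡∣p∣ : (∀ a b → f a ≡ f b → a ≡ b) → ∀ p → ∣ image p ∣ ≡ ∣ p ∣
    injective⇒∣image∣≡∣p∣ f-inj p = ≤-antisym (∣image∣≤∣p∣ p) (injective⇒∣p∣≤∣image∣ f-inj p)

open SubsetCounting

-- Vertices contained in every MEG-set

module _ {G : Graph} where

  data Visits (x : Vertex G) : ∀ {u v} → Walk G u v → Set where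
    here  : ∀ {v} {p : Walk G x v} → Visits x p
    there : ∀ {u w v} (e : adj G u w ≡ true) {p : Walk G w v} → Visits x p → Visits x (e ∷ p)

  EdgeOn⇒Visits : ∀ {x y u v} {p : Walk G u v} → EdgeOn x y p → Visits x p
  EdgeOn⇒Visits (here-xy e p) = here
  EdgeOn⇒Visits (here-yx e p) = there e here
  EdgeOn⇒Visits (there e h)   = there e (EdgeOn⇒Visits h)

  Visits-++⁻ : ∀ {x u v w} (p : Walk G u v) {q : Walk G v w} →
               Visits x (p ++ q) → Visits x p ⊎ Visits x q
  Visits-++⁻ []      h           = inj₂ h
  Visits-++⁻ (e ∷ p) here        = inj₁ here
  Visits-++⁻ (e ∷ p) (there e h) = map₁ (there e) (Visits-++⁻ p h)

  Visits⇒split : ∀ {x u v} {p : Walk G u v} → Visits x p →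
                 Σ (Walk G u x) λ p₁ → Σ (Walk G x v) λ p₂ → walkLength p₁ + walkLength p₂ ≡ walkLength p
  Visits⇒split {p = p} here = [] , p , refl
  Visits⇒split (there e h) with Visits⇒split h
  ... | p₁ , p₂ , |p₁|+|p₂|≡ = e ∷ p₁ , p₂ , cong suc |p₁|+|p₂|≡

  shortcut : ∀ {u v} {p : Walk G u v} → IsShortest p →
             (q : Walk G u v) (d : ℕ) → walkLength p ≡ suc (walkLength q + d) → ⊥
  shortcut sh q d |p|≡ = shorter-than-shortest sh q (≤-trans (s≤s (m≤m+n _ d)) (≤-reflexive (sym |p|≡)))

  record Interior (x : Vertex G) {u v} (p : Walk G u v) : Set where
    constructor interior
    field
      {s t}  : Vertex G
      before : Walk G u s
      enter  : adj G s x ≡ true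
      leave  : adj G x t ≡ true
      after  : Walk G t v
      p≡     : p ≡ before ++ enter ∷ leave ∷ after

  Passes : (x y : Vertex G) → ∀ {u v} → Walk G u v → Set
  Passes x y p = Σ (Interior x p) λ I → Interior.s I ≡ y ⊎ Interior.t I ≡ y

  private
    Passes-∷ : ∀ {x y u w v} (e : adj G u w ≡ true) {p : Walk G w v} → Passes x y p → Passes x y (e ∷ p)
    Passes-∷ e (interior before enter leave after refl , side) =
      interior (e ∷ before) enter leave after refl , side

  EdgeOn⇒Passes : ∀ {x y u v} (p : Walk G u v) → u ≢ x → v ≢ x → EdgeOn x y p → Passes x y p
  EdgeOn⇒Passes (e ∷ p) u≢x v≢x h with EdgeOn-∷⁻ h
  ... | inj₁ (refl , _) = ⊥-elim (u≢x refl)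
  EdgeOn⇒Passes (e ∷ [])     u≢x v≢x h | inj₂ (inj₁ (refl , refl)) = ⊥-elim (v≢x refl)
  EdgeOn⇒Passes (e ∷ e′ ∷ p) u≢x v≢x h | inj₂ (inj₁ (refl , refl)) = interior [] e e′ p refl , inj₁ refl
  EdgeOn⇒Passes {x} (_∷_ {w = w} e p) u≢x v≢x h | inj₂ (inj₂ h′) with w ≟ x
  ... | no w≢x = Passes-∷ e (EdgeOn⇒Passes p w≢x v≢x h′)
  EdgeOn⇒Passes (e ∷ e′ ∷ p) u≢x v≢x h | inj₂ (inj₂ h′) | yes refl with EdgeOn-∷⁻ h′
  ... | inj₁ (_ , refl)        = interior [] e e′ p refl , inj₂ refl
  ... | inj₂ (inj₁ (_ , t≡x))  = ⊥-elim (adj⇒≢ G e′ (sym t≡x))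
  ... | inj₂ (inj₂ h″)         =
    Passes-∷ e (Passes-∷ e′ (EdgeOn⇒Passes p (λ t≡x → adj⇒≢ G e′ (sym t≡x)) v≢x h″))

  no-revisit-before : ∀ {u s x t v} (p₁ : Walk G u s) (e₁ : adj G s x ≡ true)
                      (e₂ : adj G x t ≡ true) (p₂ : Walk G t v) →
                      IsShortest (p₁ ++ e₁ ∷ e₂ ∷ p₂) → ¬ Visits x p₁
  no-revisit-before p₁ e₁ e₂ p₂ sh x∈p₁ with Visits⇒split x∈p₁
  ... | q₁ , q₂ , |q₁|+|q₂|≡|p₁| = shortcut sh (q₁ ++ e₂ ∷ p₂) (walkLength q₂) (begin
    walkLength (p₁ ++ e₁ ∷ e₂ ∷ p₂)                              ≡⟨ walkLength-++ p₁ _ ⟩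
    walkLength p₁ + suc (suc (walkLength p₂))                    ≡⟨ cong (_+ _) |q₁|+|q₂|≡|p₁| ⟨
    (walkLength q₁ + walkLength q₂) + suc (suc (walkLength p₂))  ≡⟨ rearrange (walkLength q₁) (walkLength q₂) (walkLength p₂) ⟩
    suc ((walkLength q₁ + suc (walkLength p₂)) + walkLength q₂)  ≡⟨ cong (λ ℓ → suc (ℓ + _)) (walkLength-++ q₁ _) ⟨
    suc (walkLength (q₁ ++ e₂ ∷ p₂) + walkLength q₂)             ∎)
    where
      open ≡-Reasoning
      rearrange : ∀ a b c → (a + b) + suc (suc c) ≡ suc ((a + suc c) + b)
      rearrange = solve-∀

  no-revisit-after : ∀ {u s x t v} (p₁ : Walk G u s) (e₁ : adj G s x ≡ true)
                     (e₂ : adj G x t ≡ true) (p₂ : Walk G t v) →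
                     IsShortest (p₁ ++ e₁ ∷ e₂ ∷ p₂) → ¬ Visits x p₂
  no-revisit-after p₁ e₁ e₂ p₂ sh x∈p₂ with Visits⇒split x∈p₂
  ... | q₁ , q₂ , |q₁|+|q₂|≡|p₂| = shortcut sh (p₁ ++ e₁ ∷ q₂) (walkLength q₁) (begin
    walkLength (p₁ ++ e₁ ∷ e₂ ∷ p₂)                              ≡⟨ walkLength-++ p₁ _ ⟩
    walkLength p₁ + suc (suc (walkLength p₂))                    ≡⟨ cong (λ ℓ → _ + suc (suc ℓ)) |q₁|+|q₂|≡|p₂| ⟨
    walkLength p₁ + suc (suc (walkLength q₁ + walkLength q₂))    ≡⟨ rearrange (walkLength p₁) (walkLength q₁) (walkLength q₂) ⟩
    suc ((walkLength p₁ + suc (walkLength q₂)) + walkLength q₁)  ≡⟨ cong (λ ℓ → suc (ℓ + _)) (walkLength-++ p₁ _) ⟨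
    suc (walkLength (p₁ ++ e₁ ∷ q₂) + walkLength q₁)             ∎)
    where
      open ≡-Reasoning
      rearrange : ∀ a b c → a + suc (suc (b + c)) ≡ suc ((a + suc c) + b)
      rearrange = solve-∀

  Detour : Vertex G → Vertex G → Vertex G → Set
  Detour x s t = s ≡ t ⊎ adj G s t ≡ true ⊎ ∃ λ w → w ≢ x × adj G s w ≡ true × adj G w t ≡ true

  Detour-sym : ∀ {x s t} → Detour x s t → Detour x t s
  Detour-sym (inj₁ refl)                  = inj₁ refl
  Detour-sym (inj₂ (inj₁ e))              = inj₂ (inj₁ (adj-flip G e))
  Detour-sym (inj₂ (inj₂ (w , w≢x , e , e′))) = inj₂ (inj₂ (w , w≢x , adj-flip G e′ , adj-flip G e))

  no-detour : ∀ {u s x t v y} (p₁ : Walk G u s) (e₁ : adj G s x ≡ true)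
              (e₂ : adj G x t ≡ true) (p₂ : Walk G t v) →
              IsShortest (p₁ ++ e₁ ∷ e₂ ∷ p₂) → Monitors G u v x y → ¬ Detour x s t
  no-detour p₁ e₁ e₂ p₂ sh mon (inj₁ refl) = shortcut sh (p₁ ++ p₂) 1 (begin
    walkLength (p₁ ++ e₁ ∷ e₂ ∷ p₂)            ≡⟨ walkLength-++ p₁ _ ⟩
    walkLength p₁ + suc (suc (walkLength p₂))  ≡⟨ rearrange (walkLength p₁) (walkLength p₂) ⟩
    suc ((walkLength p₁ + walkLength p₂) + 1)  ≡⟨ cong (λ ℓ → suc (ℓ + 1)) (walkLength-++ p₁ p₂) ⟨
    suc (walkLength (p₁ ++ p₂) + 1)            ∎)
    where
      open ≡-Reasoning
      rearrange : ∀ a b → a + suc (suc b) ≡ suc ((a + b) + 1)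
      rearrange = solve-∀
  no-detour p₁ e₁ e₂ p₂ sh mon (inj₂ (inj₁ e)) = shortcut sh (p₁ ++ e ∷ p₂) 0 (begin
    walkLength (p₁ ++ e₁ ∷ e₂ ∷ p₂)            ≡⟨ walkLength-++ p₁ _ ⟩
    walkLength p₁ + suc (suc (walkLength p₂))  ≡⟨ +-suc _ _ ⟩
    suc (walkLength p₁ + suc (walkLength p₂))  ≡⟨ cong suc (walkLength-++ p₁ _) ⟨
    suc (walkLength (p₁ ++ e ∷ p₂))            ≡⟨ cong suc (+-identityʳ _) ⟨
    suc (walkLength (p₁ ++ e ∷ p₂) + 0)        ∎)
    where open ≡-Reasoning
  no-detour p₁ e₁ e₂ p₂ sh mon (inj₂ (inj₂ (w , w≢x , e , e′)))
    with Visits-++⁻ p₁ (EdgeOn⇒Visits (mon (p₁ ++ e ∷ e′ ∷ p₂) sh′))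
    where
      sh′ : IsShortest (p₁ ++ e ∷ e′ ∷ p₂)
      sh′ r = subst (_≤ walkLength r) (trans (walkLength-++ p₁ _) (sym (walkLength-++ p₁ _))) (sh r)
  ... | inj₁ x∈p₁                 = no-revisit-before p₁ e₁ e₂ p₂ sh x∈p₁
  ... | inj₂ here                 = adj⇒≢ G e₁ refl
  ... | inj₂ (there _ here)       = w≢x refl
  ... | inj₂ (there _ (there _ x∈p₂)) = no-revisit-after p₁ e₁ e₂ p₂ sh x∈p₂

  Detours : Vertex G → Vertex G → Set
  Detours x y = ∀ z → adj G x z ≡ true → Detour x z y

  forced : Connected G → ∀ {x y} → adj G x y ≡ true → Detours x y →
           ∀ M → IsMEGSet G M → x ∈ M
  forced conn {x} {y} e lc M meg with meg x y e
  ... | u , v , u∈M , v∈M , mon with u ≟ x | v ≟ x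
  ...   | yes refl | _        = u∈M
  ...   | no _     | yes refl = v∈M
  ...   | no u≢x   | no v≢x with shortest (conn u v)
  ...     | p , sh with EdgeOn⇒Passes p u≢x v≢x (mon p sh)
  ...       | interior p₁ e₁ e₂ p₂ refl , inj₁ refl =
                ⊥-elim (no-detour p₁ e₁ e₂ p₂ sh mon (Detour-sym (lc _ e₂)))
  ...       | interior p₁ e₁ e₂ p₂ refl , inj₂ refl =
                ⊥-elim (no-detour p₁ e₁ e₂ p₂ sh mon (lc _ (adj-flip G e₁)))

  pendant-forced : Connected G → ∀ {x y} → adj G x y ≡ true → (∀ z → adj G x z ≡ true → z ≡ y) →
                   ∀ M → IsMEGSet G M → x ∈ M
  pendant-forced conn e only-y = forced conn e λ z e′ → inj₁ (only-y z e′)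

-- Unique geodesics of length two and three

module _ {G : Graph} where

  data Via₁ (c : Vertex G) {u v : Vertex G} : Walk G u v → Set where
    via : (e : adj G u c ≡ true) (e′ : adj G c v ≡ true) → Via₁ c (e ∷ e′ ∷ [])

  data Via₂ (c₁ c₂ : Vertex G) {u v : Vertex G} : Walk G u v → Set where
    via : (e : adj G u c₁ ≡ true) (e′ : adj G c₁ c₂ ≡ true) (e″ : adj G c₂ v ≡ true) →
          Via₂ c₁ c₂ (e ∷ e′ ∷ e″ ∷ [])

  module _ {u v c : Vertex G} (u≢v : u ≢ v) (u≁v : adj G u v ≢ true)
           (uc : adj G u c ≡ true) (cv : adj G c v ≡ true)
           (unique : ∀ w → adj G u w ≡ true → adj G w v ≡ true → w ≡ c) where

    geodesic₂ : (p : Walk G u v) → IsShortest p → Via₁ c p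
    geodesic₂ []                   sh = ⊥-elim (u≢v refl)
    geodesic₂ (e ∷ [])             sh = ⊥-elim (u≁v e)
    geodesic₂ (_∷_ {w = w} e (e′ ∷ [])) sh with unique w e e′
    ... | refl = via e e′
    geodesic₂ (_ ∷ _ ∷ _ ∷ _)      sh with sh (uc ∷ cv ∷ [])
    ... | s≤s (s≤s ())

    monitors-geodesic₂ : Monitors G u v u c × Monitors G u v c v
    monitors-geodesic₂ = first , second
      where
        first : Monitors G u v u c
        first p sh with geodesic₂ p sh
        ... | via e e′ = here-xy e _
        second : Monitors G u v c v
        second p sh with geodesic₂ p sh
        ... | via e e′ = there e (here-xy e′ [])

  module _ {u v c₁ c₂ : Vertex G} (u≢v : u ≢ v) (u≁v : adj G u v ≢ true)
           (no-common : ∀ w → adj G u w ≡ true → adj G w v ≡ true → ⊥)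
           (uc₁ : adj G u c₁ ≡ true) (c₁c₂ : adj G c₁ c₂ ≡ true) (c₂v : adj G c₂ v ≡ true)
           (unique : ∀ w₁ w₂ → adj G u w₁ ≡ true → adj G w₁ w₂ ≡ true → adj G w₂ v ≡ true →
                     w₁ ≡ c₁ × w₂ ≡ c₂) where

    geodesic₃ : (p : Walk G u v) → IsShortest p → Via₂ c₁ c₂ p
    geodesic₃ []                  sh = ⊥-elim (u≢v refl)
    geodesic₃ (e ∷ [])            sh = ⊥-elim (u≁v e)
    geodesic₃ (_∷_ {w = w} e (e′ ∷ [])) sh = ⊥-elim (no-common w e e′)
    geodesic₃ (_∷_ {w = w₁} e (_∷_ {w = w₂} e′ (e″ ∷ []))) sh with unique w₁ w₂ e e′ e″
    ... | refl , refl = via e e′ e″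
    geodesic₃ (_ ∷ _ ∷ _ ∷ _ ∷ _) sh with sh (uc₁ ∷ c₁c₂ ∷ c₂v ∷ [])
    ... | s≤s (s≤s (s≤s ()))

    monitors-geodesic₃ : Monitors G u v u c₁ × Monitors G u v c₁ c₂ × Monitors G u v c₂ v
    monitors-geodesic₃ = first , second , third
      where
        first : Monitors G u v u c₁
        first p sh with geodesic₃ p sh
        ... | via e e′ e″ = here-xy e _
        second : Monitors G u v c₁ c₂
        second p sh with geodesic₃ p sh
        ... | via e e′ e″ = there e (here-xy e′ _)
        third : Monitors G u v c₂ v
        third p sh with geodesic₃ p sh
        ... | via e e′ e″ = there e (there e′ (here-xy e″ []))

-- Clique-sums

swap : ∀ {k G₁ G₂ G} → IsCliqueSum k G₁ G₂ G → IsCliqueSum k G₂ G₁ G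
swap cs = record
  { C₁ = C₂ ; C₂ = C₁ ; C₁-inj = C₂-inj ; C₂-inj = C₁-inj ; C₁-cl = C₂-cl ; C₂-cl = C₁-cl
  ; f₁ = f₂ ; f₂ = f₁ ; f₁-inj = f₂-inj ; f₂-inj = f₁-inj
  ; cover = λ z → Sum.swap (cover z)
  ; glue  = λ b a → mk⇔ (λ eq → let i , a≡ , b≡ = to (glue a b) (sym eq) in i , b≡ , a≡)
                        (λ (i , b≡ , a≡) → sym (from (glue a b) (i , a≡ , b≡)))
  ; edges = λ z w → mk⇔ (λ e → Sum.swap (to (edges z w) e)) (λ h → from (edges z w) (Sum.swap h))
  }
  where open IsCliqueSum cs

module Side {k : ℕ} {G₁ G₂ G : Graph} (cs : IsCliqueSum k G₁ G₂ G) where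
  open IsCliqueSum cs

  Img : Vertex G → Set
  Img z = ∃ λ a → f₁ a ≡ z

  img? : ∀ z → Dec (Img z)
  img? z = any? λ a → f₁ a ≟ z

  InC : Vertex G₁ → Set
  InC a = ∃ λ i → a ≡ C₁ i

  inC? : ∀ a → Dec (InC a)
  inC? a = any? λ i → a ≟ C₁ i

  glued : ∀ i → f₁ (C₁ i) ≡ f₂ (C₂ i)
  glued i = from (glue (C₁ i) (C₂ i)) (i , refl , refl)

  map-adj : ∀ {a a′} → adj G₁ a a′ ≡ true → adj G (f₁ a) (f₁ a′) ≡ true
  map-adj {a} {a′} e = from (edges (f₁ a) (f₁ a′)) (inj₁ (a , a′ , refl , refl , e))

  -- an edge of G₂ between two vertices of G₁ lies in the clique, hence is an edge of G₁ too
  lift-adj : ∀ {z w a a′} → adj G z w ≡ true → f₁ a ≡ z → f₁ a′ ≡ w → adj G₁ a a′ ≡ true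
  lift-adj {z} {w} {a} {a′} e refl refl with to (edges z w) e
  ... | inj₁ (b , b′ , fb≡ , fb′≡ , e₁) with f₁-inj b a fb≡ | f₁-inj b′ a′ fb′≡
  ...   | refl | refl = e₁
  lift-adj {z} {w} {a} {a′} e refl refl | inj₂ (b , b′ , fb≡ , fb′≡ , e₂)
    with to (glue a b) (sym fb≡) | to (glue a′ b′) (sym fb′≡)
  ... | i , refl , refl | j , refl , refl = C₁-cl i j λ { refl → adj⇒≢ G e refl }

  neighbour : ∀ {a w} → ¬ InC a → adj G (f₁ a) w ≡ true → ∃ λ a′ → f₁ a′ ≡ w × adj G₁ a a′ ≡ true
  neighbour {a} {w} a∉C e with to (edges (f₁ a) w) e
  ... | inj₁ (b , b′ , fb≡ , fb′≡ , e₁) with f₁-inj b a fb≡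
  ...   | refl = b′ , fb′≡ , e₁
  neighbour {a} a∉C e | inj₂ (b , b′ , fb≡ , _ , _) with to (glue a b) (sym fb≡)
  ...   | i , a≡ , _ = ⊥-elim (a∉C (i , a≡))

  pendant-image : ∀ {a c} → ¬ InC a → (∀ z → adj G₁ a z ≡ true → z ≡ c) →
                  ∀ w → adj G (f₁ a) w ≡ true → w ≡ f₁ c
  pendant-image a∉C only-c w e = let a′ , fa′≡ , e′ = neighbour a∉C e in trans (sym fa′≡) (cong f₁ (only-c a′ e′))

  leave-clique : ∀ {z w a} → adj G z w ≡ true → f₁ a ≡ z → ¬ Img w → InC a
  leave-clique {a = a} e refl w∉ with inC? a
  ... | yes a∈C = a∈C
  ... | no a∉C  = ⊥-elim (w∉ (let a′ , fa′≡ , _ = neighbour a∉C e in a′ , fa′≡))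

  enter-clique : ∀ {z w a} → adj G z w ≡ true → ¬ Img z → f₁ a ≡ w → InC a
  enter-clique e z∉ fa≡ = leave-clique (adj-flip G e) fa≡ z∉

  map-walk : ∀ {a a′} → Walk G₁ a a′ → Walk G (f₁ a) (f₁ a′)
  map-walk []      = []
  map-walk (e ∷ p) = map-adj e ∷ map-walk p

  walkLength-map : ∀ {a a′} (p : Walk G₁ a a′) → walkLength (map-walk p) ≡ walkLength p
  walkLength-map []      = refl
  walkLength-map (e ∷ p) = cong suc (walkLength-map p)

  EdgeOn-map⁻ : ∀ {x y a a′} (p : Walk G₁ a a′) → EdgeOn (f₁ x) (f₁ y) (map-walk p) → EdgeOn x y p
  EdgeOn-map⁻ (e ∷ p) h with EdgeOn-∷⁻ h
  ... | inj₁ (a≡ , a′≡)        = EdgeOn-head e p (inj₁ (f₁-inj _ _ a≡ , f₁-inj _ _ a′≡))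
  ... | inj₂ (inj₁ (a≡ , a′≡)) = EdgeOn-head e p (inj₂ (f₁-inj _ _ a≡ , f₁-inj _ _ a′≡))
  ... | inj₂ (inj₂ h′)         = there e (EdgeOn-map⁻ p h′)

  Along : ∀ {a a′ z w} → Walk G₁ a a′ → Walk G z w → Set
  Along q p = ∀ {x y} → EdgeOn x y q → EdgeOn (f₁ x) (f₁ y) p

  Projection : ∀ {z w} → Vertex G₁ → Vertex G₁ → Walk G z w → Set
  Projection a a′ p = Σ (Walk G₁ a a′) λ q →
    walkLength q ≤ walkLength p × (walkLength q < walkLength p ⊎ Along q p)

  -- An excursion of a walk outside the image of G₁ leaves and re-enters through the
  -- clique, so it can be replaced by at most one clique edge.
  mutual
    project : ∀ {a a′ z w} (p : Walk G z w) → f₁ a ≡ z → f₁ a′ ≡ w → Projection a a′ p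
    project {a} {a′} [] refl fa′≡ with f₁-inj a a′ (sym fa′≡)
    ... | refl = [] , z≤n , inj₂ λ ()
    project (_∷_ {w = z′} e p) fa≡ fa′≡ with img? z′
    ... | yes (a₁ , refl) with project p refl fa′≡
    ...   | q , q≤p , shorter-or-along =
              lift-adj e fa≡ refl ∷ q , s≤s q≤p , Sum.map s≤s (along-∷ fa≡) shorter-or-along
      where
        along-∷ : ∀ {a} (fa≡ : f₁ a ≡ _) → Along q p → Along (lift-adj e fa≡ refl ∷ q) (e ∷ p)
        along-∷ refl al h with EdgeOn-∷⁻ h
        ... | inj₁ (refl , refl)        = here-xy e p
        ... | inj₂ (inj₁ (refl , refl)) = here-yx e p
        ... | inj₂ (inj₂ h′)            = there e (al h′)
    project (_∷_ {w = z′} e p) fa≡ fa′≡ | no z′∉ with leave-clique e fa≡ z′∉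
    ... | i , refl with project-outside i p z′∉ fa′≡
    ...   | q , q≤p = q , m≤n⇒m≤1+n q≤p , inj₁ (s≤s q≤p)

    project-outside : ∀ {a′ z w} (i : Fin k) (p : Walk G z w) → ¬ Img z → f₁ a′ ≡ w →
                      Σ (Walk G₁ (C₁ i) a′) λ q → walkLength q ≤ walkLength p
    project-outside i [] z∉ fa′≡ = ⊥-elim (z∉ (_ , fa′≡))
    project-outside i (_∷_ {w = z′} e p) z∉ fa′≡ with img? z′
    ... | no z′∉ with project-outside i p z′∉ fa′≡
    ...   | q , q≤p = q , m≤n⇒m≤1+n q≤p
    project-outside i (_∷_ {w = z′} e p) z∉ fa′≡ | yes (a₁ , refl) with enter-clique e z∉ refl
    ... | j , refl with project p refl fa′≡ | i ≟ j
    ...   | q , q≤p , _ | yes refl = q , m≤n⇒m≤1+n q≤p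
    ...   | q , q≤p , _ | no i≢j   = C₁-cl i j i≢j ∷ q , s≤s q≤p

  projection : ∀ {a a′} (p : Walk G (f₁ a) (f₁ a′)) → Projection a a′ p
  projection p = project p refl refl

  map-shortest : ∀ {a a′} {q : Walk G₁ a a′} → IsShortest q → IsShortest (map-walk q)
  map-shortest {q = q} sh r = let q′ , q′≤r , _ = projection r in
    subst (_≤ walkLength r) (sym (walkLength-map q)) (≤-trans (sh q′) q′≤r)

  monitors-down : ∀ {a a′ x y} → Monitors G (f₁ a) (f₁ a′) (f₁ x) (f₁ y) → Monitors G₁ a a′ x y
  monitors-down mon q sh = EdgeOn-map⁻ q (mon (map-walk q) (map-shortest sh))

  monitors-up : ∀ {a a′ x y} → Monitors G₁ a a′ x y → Monitors G (f₁ a) (f₁ a′) (f₁ x) (f₁ y)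
  monitors-up mon p sh with projection p
  ... | q , q≤p , inj₁ q<p = ⊥-elim (shorter-than-shortest sh (map-walk q) (subst (_< _) (sym (walkLength-map q)) q<p))
  ... | q , q≤p , inj₂ al  = al (mon q λ q′ → ≤-trans q≤p (subst (_ ≤_) (walkLength-map q′) (sh (map-walk q′))))

  private
    Avoids : ∀ {z w} → Vertex G₁ → Vertex G₁ → Walk G z w → Set
    Avoids x y p = ¬ EdgeOn (f₁ x) (f₁ y) p

  entry : ∀ {z v x y} (p : Walk G z v) → ¬ Img z → EdgeOn (f₁ x) (f₁ y) p →
          Σ (Fin k) λ j → Σ (Walk G z (f₁ (C₁ j))) λ p₁ → Σ (Walk G (f₁ (C₁ j)) v) λ p₂ →
            p ≡ p₁ ++ p₂ × Avoids x y p₁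
  entry {x = x} {y} (_∷_ {w = z′} e p) z∉ h with EdgeOn-∷⁻ h
  ... | inj₁ (refl , _)        = ⊥-elim (z∉ (_ , refl))
  ... | inj₂ (inj₁ (refl , _)) = ⊥-elim (z∉ (_ , refl))
  ... | inj₂ (inj₂ h′) with img? z′
  ...   | yes (a₁ , refl) with enter-clique e z∉ refl
  ...     | j , refl = j , e ∷ [] , p , refl , avoid
    where
      avoid : Avoids x y (e ∷ [])
      avoid h₀ with EdgeOn-∷⁻ h₀
      ... | inj₁ (refl , _)        = z∉ (_ , refl)
      ... | inj₂ (inj₁ (refl , _)) = z∉ (_ , refl)
  entry {x = x} {y} (_∷_ {w = z′} e p) z∉ h | inj₂ (inj₂ h′) | no z′∉ with entry p z′∉ h′
  ... | j , p₁ , p₂ , refl , p₁-avoids = j , e ∷ p₁ , p₂ , refl , avoid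
    where
      avoid : Avoids x y (e ∷ p₁)
      avoid h₀ with EdgeOn-∷⁻ h₀
      ... | inj₁ (refl , _)        = z∉ (_ , refl)
      ... | inj₂ (inj₁ (refl , _)) = z∉ (_ , refl)
      ... | inj₂ (inj₂ h₁)         = p₁-avoids h₁

  monitors-from-image : ∀ {u v x y} → Monitors G u v (f₁ x) (f₁ y) → Walk G u v →
                        ∃ λ a → (f₁ a ≡ u ⊎ InC a) × Monitors G (f₁ a) v (f₁ x) (f₁ y)
  monitors-from-image {u} mon uv with img? u
  ... | yes (a , refl) = a , inj₁ refl , mon
  ... | no u∉ with shortest uv
  ...   | p , sh with entry p u∉ (mon p sh)
  ...     | j , p₁ , p₂ , refl , p₁-avoids = C₁ j , inj₂ (j , refl) , monitors-suffix mon p₁ p₂ sh p₁-avoids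

  restrict-monitors : Connected G → ∀ {u v x y} → Monitors G u v (f₁ x) (f₁ y) →
                      ∃ λ a → ∃ λ a′ → (f₁ a ≡ u ⊎ InC a) × (f₁ a′ ≡ v ⊎ InC a′) × Monitors G₁ a a′ x y
  restrict-monitors conn {u} {v} mon with monitors-from-image mon (conn u v)
  ... | a , a≈u , mon₁ with monitors-from-image (monitors-reverse mon₁) (conn v (f₁ a))
  ...   | a′ , a′≈v , mon₂ = a , a′ , a≈u , a′≈v , monitors-down (monitors-reverse mon₂)

  image-monitors : ∀ {M₁} → IsMEGSet G₁ M₁ → ∀ {a a′} → adj G₁ a a′ ≡ true →
                   MonitoredBy G (image f₁ M₁) (f₁ a) (f₁ a′)
  image-monitors meg {a} {a′} e with meg a a′ e
  ... | u , v , u∈ , v∈ , mon = f₁ u , f₁ v , ∈-image⁺ f₁ u∈ , ∈-image⁺ f₁ v∈ , monitors-up mon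

  private-part : Subset (n G) → Subset (n G₁)
  private-part M = subsetOf λ a → (f₁ a ∈? M) ×-dec ¬? (inC? a)

  restriction : Subset (n G) → Subset (n G₁)
  restriction M = subsetOf λ a → (f₁ a ∈? M) ⊎-dec inC? a

  restriction-MEG : Connected G → ∀ {M} → IsMEGSet G M → IsMEGSet G₁ (restriction M)
  restriction-MEG conn {M} meg x y e with meg (f₁ x) (f₁ y) (map-adj e)
  ... | u , v , u∈M , v∈M , mon with restrict-monitors conn mon
  ...   | a , a′ , a≈u , a′≈v , mon′ = a , a′ , restricted a≈u u∈M , restricted a′≈v v∈M , mon′
    where
      restricted : ∀ {a w} → f₁ a ≡ w ⊎ InC a → w ∈ M → a ∈ restriction M
      restricted (inj₁ refl) w∈M = ∈-subsetOf⁺ _ (inj₁ w∈M)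
      restricted (inj₂ a∈C)  _   = ∈-subsetOf⁺ _ (inj₂ a∈C)

  ∣restriction∣≤ : ∀ M → ∣ restriction M ∣ ≤ ∣ private-part M ∣ + k
  ∣restriction∣≤ M = begin
    ∣ restriction M ∣                         ≤⟨ p⊆q⇒∣p∣≤∣q∣ restriction⊆ ⟩
    ∣ private-part M ∪ image C₁ ⊤ ∣            ≤⟨ ∣p∪q∣≤∣p∣+∣q∣ (private-part M) _ ⟩
    ∣ private-part M ∣ + ∣ image C₁ ⊤ ∣        ≤⟨ +-monoʳ-≤ ∣ private-part M ∣ (∣image∣≤∣p∣ C₁ ⊤) ⟩
    ∣ private-part M ∣ + ∣ ⊤ {k} ∣             ≡⟨ cong (∣ private-part M ∣ +_) (∣⊤∣≡n k) ⟩
    ∣ private-part M ∣ + k                     ∎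
    where
      open ≤-Reasoning
      restriction⊆ : restriction M ⊆ private-part M ∪ image C₁ ⊤
      restriction⊆ {a} a∈ with ∈-subsetOf⁻ _ a∈ | inC? a
      ... | _          | yes (i , refl) = x∈p∪q⁺ (inj₂ (∈-image⁺ C₁ ∈⊤))
      ... | inj₁ fa∈M  | no a∉C         = x∈p∪q⁺ (inj₁ (∈-subsetOf⁺ _ (fa∈M , a∉C)))
      ... | inj₂ a∈C   | no a∉C         = ⊥-elim (a∉C a∈C)

  side-bound : Connected G → ∀ {m₁ M} → IsMeg G₁ m₁ → IsMEGSet G M → m₁ ≤ ∣ private-part M ∣ + k
  side-bound conn {M = M} (_ , minimal) meg = ≤-trans (minimal _ (restriction-MEG conn meg)) (∣restriction∣≤ M)

module Bounds {k : ℕ} {G₁ G₂ G : Graph} (cs : IsCliqueSum k G₁ G₂ G) where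
  open IsCliqueSum cs
  module S₁ = Side cs
  module S₂ = Side (swap cs)

  connected : Fin k → Connected G₁ → Connected G₂ → Connected G
  connected i conn₁ conn₂ z w = to-hub z ++ reverse (to-hub w)
    where
      to-hub : ∀ z → Walk G z (f₁ (C₁ i))
      to-hub z with cover z
      ... | inj₁ (a , refl) = S₁.map-walk (conn₁ a (C₁ i))
      ... | inj₂ (b , refl) = subst (Walk G _) (sym (S₁.glued i)) (S₂.map-walk (conn₂ b (C₂ i)))

  images-disjoint : ∀ {P₁ P₂} → (∀ {a} → a ∈ P₁ → ¬ S₁.InC a) →
                    ∀ z → z ∈ image f₁ P₁ → z ∈ image f₂ P₂ → ⊥
  images-disjoint P₁∩C=∅ z z∈₁ z∈₂ with ∈-image⁻ f₁ z∈₁ | ∈-image⁻ f₂ z∈₂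
  ... | a , a∈ , refl | b , _ , fb≡ with to (glue a b) (sym fb≡)
  ...   | i , a≡ , _ = P₁∩C=∅ a∈ (i , a≡)

  ∣images∣≤ : ∀ P₁ P₂ → ∣ image f₁ P₁ ∪ image f₂ P₂ ∣ ≤ ∣ P₁ ∣ + ∣ P₂ ∣
  ∣images∣≤ P₁ P₂ = begin
    ∣ image f₁ P₁ ∪ image f₂ P₂ ∣      ≤⟨ ∣p∪q∣≤∣p∣+∣q∣ (image f₁ P₁) _ ⟩
    ∣ image f₁ P₁ ∣ + ∣ image f₂ P₂ ∣  ≤⟨ +-mono-≤ (∣image∣≤∣p∣ f₁ P₁) (∣image∣≤∣p∣ f₂ P₂) ⟩
    ∣ P₁ ∣ + ∣ P₂ ∣                    ∎
    where open ≤-Reasoning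

  ∣images∣≥ : ∀ {P₁ P₂} → (∀ {a} → a ∈ P₁ → ¬ S₁.InC a) → ∣ P₁ ∣ + ∣ P₂ ∣ ≤ ∣ image f₁ P₁ ∪ image f₂ P₂ ∣
  ∣images∣≥ {P₁} {P₂} P₁∩C=∅ = begin
    ∣ P₁ ∣ + ∣ P₂ ∣                     ≤⟨ +-mono-≤ (injective⇒∣p∣≤∣image∣ f₁ f₁-inj P₁) (injective⇒∣p∣≤∣image∣ f₂ f₂-inj P₂) ⟩
    ∣ image f₁ P₁ ∣ + ∣ image f₂ P₂ ∣   ≤⟨ disjoint⇒∣p∣+∣q∣≤∣p∪q∣ (image f₁ P₁) (image f₂ P₂) (images-disjoint P₁∩C=∅) ⟩
    ∣ image f₁ P₁ ∪ image f₂ P₂ ∣       ∎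
    where open ≤-Reasoning

  ∣private-parts∣≤ : ∀ M → ∣ S₁.private-part M ∣ + ∣ S₂.private-part M ∣ ≤ ∣ M ∣
  ∣private-parts∣≤ M = ≤-trans (∣images∣≥ (λ a∈ → proj₂ (∈-subsetOf⁻ _ a∈))) (p⊆q⇒∣p∣≤∣q∣ images⊆M)
    where
      images⊆M : image f₁ (S₁.private-part M) ∪ image f₂ (S₂.private-part M) ⊆ M
      images⊆M z∈ with x∈p∪q⁻ (image f₁ (S₁.private-part M)) _ z∈
      ... | inj₁ z∈₁ = let a , a∈ , fa≡ = ∈-image⁻ f₁ z∈₁ in subst (_∈ M) fa≡ (proj₁ (∈-subsetOf⁻ _ a∈))
      ... | inj₂ z∈₂ = let b , b∈ , fb≡ = ∈-image⁻ f₂ z∈₂ in subst (_∈ M) fb≡ (proj₁ (∈-subsetOf⁻ _ b∈))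

  lower-bound : Connected G → ∀ {m₁ m₂ M} → IsMeg G₁ m₁ → IsMeg G₂ m₂ → IsMEGSet G M →
                m₁ + m₂ ≤ ∣ M ∣ + 2 * k
  lower-bound conn {m₁} {m₂} {M} meg₁ meg₂ meg = begin
    m₁ + m₂                                      ≤⟨ +-mono-≤ (S₁.side-bound conn meg₁ meg) (S₂.side-bound conn meg₂ meg) ⟩
    (∣ P₁ ∣ + k) + (∣ P₂ ∣ + k)                  ≡⟨ rearrange ∣ P₁ ∣ ∣ P₂ ∣ k ⟩
    (∣ P₁ ∣ + ∣ P₂ ∣) + 2 * k                    ≤⟨ +-monoˡ-≤ (2 * k) (∣private-parts∣≤ M) ⟩
    ∣ M ∣ + 2 * k                                ∎
    where
      open ≤-Reasoning
      P₁ = S₁.private-part M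
      P₂ = S₂.private-part M
      rearrange : ∀ a b k → (a + k) + (b + k) ≡ (a + b) + 2 * k
      rearrange = solve-∀

  images-MEG : ∀ {M₁ M₂} → IsMEGSet G₁ M₁ → IsMEGSet G₂ M₂ → IsMEGSet G (image f₁ M₁ ∪ image f₂ M₂)
  images-MEG meg₁ meg₂ z w e with to (edges z w) e
  ... | inj₁ (a , a′ , refl , refl , e₁) =
    let u , v , u∈ , v∈ , mon = S₁.image-monitors meg₁ e₁ in u , v , x∈p∪q⁺ (inj₁ u∈) , x∈p∪q⁺ (inj₁ v∈) , mon
  ... | inj₂ (b , b′ , refl , refl , e₂) =
    let u , v , u∈ , v∈ , mon = S₂.image-monitors meg₂ e₂ in u , v , x∈p∪q⁺ (inj₂ u∈) , x∈p∪q⁺ (inj₂ v∈) , mon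

  upper-bound : ∀ {m₁ m₂ m} → IsMeg G₁ m₁ → IsMeg G₂ m₂ → IsMeg G m → m ≤ m₁ + m₂
  upper-bound ((M₁ , meg₁ , refl) , _) ((M₂ , meg₂ , refl) , _) (_ , minimal) =
    ≤-trans (minimal _ (images-MEG meg₁ meg₂)) (∣images∣≤ M₁ M₂)

module Cross {k : ℕ} {G₁ G₂ G : Graph} (cs : IsCliqueSum k G₁ G₂ G) where
  open IsCliqueSum cs
  module S₁ = Side cs
  module S₂ = Side (swap cs)

  cross-adj : ∀ {x y} → adj G (f₁ x) (f₂ y) ≡ true →
              (∃ λ l → y ≡ C₂ l × adj G₁ x (C₁ l) ≡ true) ⊎ (∃ λ l → x ≡ C₁ l × adj G₂ (C₂ l) y ≡ true)
  cross-adj {x} {y} e with to (edges (f₁ x) (f₂ y)) e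
  ... | inj₁ (a , a′ , fa≡ , fa′≡ , e₁) with f₁-inj a x fa≡ | to (glue a′ y) fa′≡
  ...   | refl | l , refl , refl = inj₁ (l , refl , e₁)
  cross-adj {x} {y} e | inj₂ (b , b′ , fb≡ , fb′≡ , e₂) with f₂-inj b′ y fb′≡ | to (glue x b) (sym fb≡)
  ...   | refl | l , refl , refl = inj₂ (l , refl , e₂)

  cross-≢ : ∀ {x y} → ¬ S₁.InC x → f₁ x ≢ f₂ y
  cross-≢ {x} {y} x∉C eq = let i , x≡ , _ = to (glue x y) eq in x∉C (i , x≡)

  cross-≁ : ∀ {x y} → ¬ S₁.InC x → ¬ S₂.InC y → adj G (f₁ x) (f₂ y) ≢ true
  cross-≁ x∉C y∉C e with cross-adj e
  ... | inj₁ (l , y≡ , _) = y∉C (l , y≡)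
  ... | inj₂ (l , x≡ , _) = x∉C (l , x≡)

  common-neighbour : ∀ {x y w} → ¬ S₁.InC x → ¬ S₂.InC y → adj G (f₁ x) w ≡ true → adj G w (f₂ y) ≡ true →
                     ∃ λ l → w ≡ f₁ (C₁ l) × adj G₁ x (C₁ l) ≡ true × adj G₂ y (C₂ l) ≡ true
  common-neighbour x∉C y∉C e e′ with S₁.neighbour x∉C e
  ... | x′ , refl , xx′ with cross-adj e′
  ...   | inj₁ (l , y≡ , _)    = ⊥-elim (y∉C (l , y≡))
  ...   | inj₂ (l , refl , e₂) = l , refl , xx′ , adj-flip G₂ e₂

  module _ {x y i} (x∉C : ¬ S₁.InC x) (y∉C : ¬ S₂.InC y)
           (xCi : adj G₁ x (C₁ i) ≡ true) (yCi : adj G₂ y (C₂ i) ≡ true)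
           (x-anchor : ∀ l → adj G₁ x (C₁ l) ≡ true → l ≡ i) where

    monitors-through-clique : Monitors G (f₁ x) (f₂ y) (f₁ x) (f₁ (C₁ i)) ×
                              Monitors G (f₁ x) (f₂ y) (f₁ (C₁ i)) (f₂ y)
    monitors-through-clique = monitors-geodesic₂ (cross-≢ x∉C) (cross-≁ x∉C y∉C) (S₁.map-adj xCi)
      (subst (λ c → adj G c (f₂ y) ≡ true) (sym (S₁.glued i)) (S₂.map-adj (adj-flip G₂ yCi)))
      λ w e e′ → let l , w≡ , xCl , _ = common-neighbour x∉C y∉C e e′ in trans w≡ (cong (f₁ ∘ C₁) (x-anchor l xCl))

  module _ {x y i j} (x∉C : ¬ S₁.InC x) (y∉C : ¬ S₂.InC y) (i≢j : i ≢ j)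
           (xCi : adj G₁ x (C₁ i) ≡ true) (yCj : adj G₂ y (C₂ j) ≡ true)
           (x-anchor : ∀ l → adj G₁ x (C₁ l) ≡ true → l ≡ i)
           (y-anchor : ∀ l → adj G₂ y (C₂ l) ≡ true → l ≡ j)
           (x-far : ∀ x′ → adj G₁ x x′ ≡ true → ¬ S₁.InC x′ → adj G₁ x′ (C₁ j) ≢ true)
           (y-far : ∀ y′ → adj G₂ y y′ ≡ true → ¬ S₂.InC y′ → adj G₂ y′ (C₂ i) ≢ true) where

    private
      unique : ∀ w₁ w₂ → adj G (f₁ x) w₁ ≡ true → adj G w₁ w₂ ≡ true → adj G w₂ (f₂ y) ≡ true →
               w₁ ≡ f₁ (C₁ i) × w₂ ≡ f₁ (C₁ j)
      unique w₁ w₂ e e′ e″ with S₁.neighbour x∉C e | S₂.neighbour y∉C (adj-flip G e″)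
      ... | x′ , refl , xx′ | y′ , refl , yy′ with cross-adj e′ | S₁.inC? x′ | S₂.inC? y′
      ...   | inj₁ (l , refl , x′Cl) | yes (l′ , refl) | _ with y-anchor l yy′ | x-anchor l′ xx′
      ...     | refl | refl = refl , sym (S₁.glued j)
      unique _ _ _ _ _ | x′ , refl , xx′ | y′ , refl , yy′ | inj₁ (l , refl , x′Cl) | no x′∉C | _
        with y-anchor l yy′
      ... | refl = ⊥-elim (x-far x′ xx′ x′∉C x′Cl)
      unique _ _ _ _ _ | x′ , refl , xx′ | y′ , refl , yy′ | inj₂ (l , refl , Cly′) | _ | yes (l′ , refl)
        with x-anchor l xx′ | y-anchor l′ yy′
      ... | refl | refl = refl , sym (S₁.glued j)
      unique _ _ _ _ _ | x′ , refl , xx′ | y′ , refl , yy′ | inj₂ (l , refl , Cly′) | _ | no y′∉C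
        with x-anchor l xx′
      ... | refl = ⊥-elim (y-far y′ yy′ y′∉C (adj-flip G₂ Cly′))

    monitors-clique-edge : Monitors G (f₁ x) (f₂ y) (f₁ (C₁ i)) (f₁ (C₁ j))
    monitors-clique-edge = proj₁ (proj₂ (monitors-geodesic₃ (cross-≢ x∉C) (cross-≁ x∉C y∉C)
      (λ w e e′ → let l , _ , xCl , yCl = common-neighbour x∉C y∉C e e′ in
                  i≢j (trans (sym (x-anchor l xCl)) (y-anchor l yCl)))
      (S₁.map-adj xCi) (S₁.map-adj (C₁-cl i j i≢j))
      (subst (λ c → adj G c (f₂ y) ≡ true) (sym (S₁.glued j)) (S₂.map-adj (adj-flip G₂ yCj)))
      unique))

-- Building clique-sums

module _ {k : ℕ} where

  _==_ : Fin k → Fin k → Bool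
  i == j = does (i ≟ j)

  ==-refl : ∀ i → (i == i) ≡ true
  ==-refl i = dec-true (i ≟ i) refl

  ==⇒≡ : ∀ {i j} → (i == j) ≡ true → i ≡ j
  ==⇒≡ {i} {j} eq with i ≟ j
  ... | yes i≡j = i≡j

  ≢⇒==-false : ∀ {i j} → i ≢ j → (i == j) ≡ false
  ≢⇒==-false {i} {j} = dec-false (i ≟ j)

  ==-sym : ∀ i j → (i == j) ≡ (j == i)
  ==-sym i j = does-⇔ (mk⇔ sym sym) (i ≟ j) (j ≟ i)

-- The graph with adjacency a on Fin m ⊎ Fin n, its vertices encoded in Fin (m + n). The
-- encoding is opaque so that unification can recover X from ⌜ X ⌝.
module SumGraph (m n : ℕ) (a : Fin m ⊎ Fin n → Fin m ⊎ Fin n → Bool)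
                (a-sym : ∀ X Y → a X Y ≡ a Y X) (a-irr : ∀ X → a X X ≡ false) where

  opaque
    ⌜_⌝ : Fin m ⊎ Fin n → Fin (m + n)
    ⌜_⌝ = join m n

    ⌞_⌟ : Fin (m + n) → Fin m ⊎ Fin n
    ⌞_⌟ = splitAt m

    ⌞⌜⌝⌟ : ∀ X → ⌞ ⌜ X ⌝ ⌟ ≡ X
    ⌞⌜⌝⌟ = splitAt-join m n

    ⌜⌞⌟⌝ : ∀ x → ⌜ ⌞ x ⌟ ⌝ ≡ x
    ⌜⌞⌟⌝ = join-splitAt m n

  graph : Graph
  graph = record
    { n       = m + n
    ; adj     = λ x y → a ⌞ x ⌟ ⌞ y ⌟
    ; adj-sym = λ x y → a-sym ⌞ x ⌟ ⌞ y ⌟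
    ; adj-irr = λ x → a-irr ⌞ x ⌟
    }

  ⌜⌝-injective : ∀ {X Y} → ⌜ X ⌝ ≡ ⌜ Y ⌝ → X ≡ Y
  ⌜⌝-injective {X} {Y} eq = trans (sym (⌞⌜⌝⌟ X)) (trans (cong ⌞_⌟ eq) (⌞⌜⌝⌟ Y))

  adj-⌜⌝ : ∀ X Y → adj graph ⌜ X ⌝ ⌜ Y ⌝ ≡ a X Y
  adj-⌜⌝ X Y = cong₂ a (⌞⌜⌝⌟ X) (⌞⌜⌝⌟ Y)

  edge : ∀ {X Y} → a X Y ≡ true → adj graph ⌜ X ⌝ ⌜ Y ⌝ ≡ true
  edge {X} {Y} = trans (adj-⌜⌝ X Y)

  edge⁻ : ∀ {X Y} → adj graph ⌜ X ⌝ ⌜ Y ⌝ ≡ true → a X Y ≡ true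
  edge⁻ {X} {Y} = trans (sym (adj-⌜⌝ X Y))

  data Decoded : Vertex graph → Set where
    ⌜_⌝ᵈ : ∀ X → Decoded ⌜ X ⌝

  decode : ∀ x → Decoded x
  decode x = subst Decoded (⌜⌞⌟⌝ x) ⌜ ⌞ x ⌟ ⌝ᵈ

  connected-via : ∀ hub → (∀ X → Walk graph ⌜ X ⌝ hub) → Connected graph
  connected-via hub to-hub x y with decode x | decode y
  ... | ⌜ X ⌝ᵈ | ⌜ Y ⌝ᵈ = to-hub X ++ reverse (to-hub Y)

  Detourᵃ : (X Z Y : Fin m ⊎ Fin n) → Set
  Detourᵃ X Z Y = Z ≡ Y ⊎ a Z Y ≡ true ⊎ ∃ λ W → W ≢ X × a Z W ≡ true × a W Y ≡ true

  Detoursᵃ : (X Y : Fin m ⊎ Fin n) → Set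
  Detoursᵃ X Y = ∀ Z → a X Z ≡ true → Detourᵃ X Z Y

  detours : ∀ {X Y} → Detoursᵃ X Y → Detours {graph} ⌜ X ⌝ ⌜ Y ⌝
  detours lc z e with decode z
  ... | ⌜ Z ⌝ᵈ with lc Z (edge⁻ e)
  ...   | inj₁ refl                       = inj₁ refl
  ...   | inj₂ (inj₁ e′)                  = inj₂ (inj₁ (edge e′))
  ...   | inj₂ (inj₂ (W , W≢X , e′ , e″)) = inj₂ (inj₂ (⌜ W ⌝ , (λ eq → W≢X (⌜⌝-injective eq)) , edge e′ , edge e″))

  every-vertex-forced : Connected graph → (∀ X → ∃ λ Y → a X Y ≡ true × Detoursᵃ X Y) → IsMeg graph (m + n)
  every-vertex-forced conn forcing = (⊤ , ⊤-MEG , ∣⊤∣≡n (m + n)) , λ M meg →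
    ≤-trans (≤-reflexive (sym (∣⊤∣≡n (m + n)))) (p⊆q⇒∣p∣≤∣q∣ {p = ⊤} (λ {x} _ → forced-vertex M meg x))
    where
      ⊤-MEG : IsMEGSet graph ⊤
      ⊤-MEG x y e = x , y , ∈⊤ , ∈⊤ , adjacent-monitors e
      forced-vertex : ∀ M → IsMEGSet graph M → ∀ x → x ∈ M
      forced-vertex M meg x with decode x
      ... | ⌜ X ⌝ᵈ = let Y , e , lc = forcing X in forced conn (edge e) (detours lc) M meg

record CliqueGraph (k : ℕ) : Set where
  field
    r            : ℕ
    anchor       : Fin r → Fin k
    outerAdj     : Fin r → Fin r → Bool
    outerAdj-sym : ∀ v w → outerAdj v w ≡ outerAdj w v
    outerAdj-irr : ∀ v → outerAdj v v ≡ false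

  adjacent : Fin k ⊎ Fin r → Fin k ⊎ Fin r → Bool
  adjacent (inj₁ i) (inj₁ j) = not (i == j)
  adjacent (inj₁ i) (inj₂ v) = i == anchor v
  adjacent (inj₂ v) (inj₁ i) = i == anchor v
  adjacent (inj₂ v) (inj₂ w) = outerAdj v w

  adjacent-sym : ∀ X Y → adjacent X Y ≡ adjacent Y X
  adjacent-sym (inj₁ i) (inj₁ j) = cong not (==-sym i j)
  adjacent-sym (inj₁ i) (inj₂ v) = refl
  adjacent-sym (inj₂ v) (inj₁ i) = refl
  adjacent-sym (inj₂ v) (inj₂ w) = outerAdj-sym v w

  adjacent-irr : ∀ X → adjacent X X ≡ false
  adjacent-irr (inj₁ i) = cong not (==-refl i)
  adjacent-irr (inj₂ v) = outerAdj-irr v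

  open SumGraph k r adjacent adjacent-sym adjacent-irr public

  clique : Fin k → Vertex graph
  clique i = ⌜ inj₁ i ⌝

  outer : Fin r → Vertex graph
  outer v = ⌜ inj₂ v ⌝

  outers : Subset (n graph)
  outers = image outer ⊤

  ∣outers∣ : ∣ outers ∣ ≡ r
  ∣outers∣ = trans (injective⇒∣image∣≡∣p∣ outer (λ v w eq → inj₂-injective (⌜⌝-injective eq)) ⊤) (∣⊤∣≡n r)

  outer≢clique : ∀ {v i} → outer v ≢ clique i
  outer≢clique {v} {i} eq with ⌜⌝-injective eq
  ... | ()

  clique-injective : ∀ i j → clique i ≡ clique j → i ≡ j
  clique-injective i j eq = inj₁-injective (⌜⌝-injective eq)

  clique-adj : ∀ {i j} → i ≢ j → adj graph (clique i) (clique j) ≡ true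
  clique-adj i≢j = edge (cong not (≢⇒==-false i≢j))

  anchor-adj : ∀ v → adj graph (outer v) (clique (anchor v)) ≡ true
  anchor-adj v = edge (==-refl (anchor v))

  anchor-unique : ∀ {v i} → adj graph (outer v) (clique i) ≡ true → i ≡ anchor v
  anchor-unique e = ==⇒≡ (edge⁻ e)

  clique-adj⁻ : ∀ {i j} → adj graph (clique i) (clique j) ≡ true → i ≢ j
  clique-adj⁻ e refl = adj⇒≢ graph e refl

  outer-neighbour : ∀ {v x} → adj graph (outer v) x ≡ true → (∀ i → x ≢ clique i) →
                    ∃ λ v′ → x ≡ outer v′ × outerAdj v v′ ≡ true
  outer-neighbour {v} {x} e x∉C with decode x
  ... | ⌜ inj₁ i ⌝ᵈ  = ⊥-elim (x∉C i refl)
  ... | ⌜ inj₂ v′ ⌝ᵈ = v′ , refl , edge⁻ e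

-- The clique-sum of H₁ and H₂ identifying clique vertex i of H₁ with clique vertex π i of H₂.
module Glue {k : ℕ} (H₁ H₂ : CliqueGraph k) (π : Fin k → Fin k) (π-invol : ∀ i → π (π i) ≡ i) where
  module H₁ = CliqueGraph H₁
  module H₂ = CliqueGraph H₂

  π-injective : ∀ i j → π i ≡ π j → i ≡ j
  π-injective i j eq = trans (sym (π-invol i)) (trans (cong π eq) (π-invol j))

  ==-π : ∀ i j → (π i == π j) ≡ (i == j)
  ==-π i j = does-⇔ (mk⇔ (π-injective i j) (cong π)) (π i ≟ π j) (i ≟ j)

  attached : Fin k ⊎ Fin H₁.r → Fin H₂.r → Bool
  attached (inj₁ i) w = π i == H₂.anchor w
  attached (inj₂ _) w = false

  aG : Vertex H₁.graph ⊎ Fin H₂.r → Vertex H₁.graph ⊎ Fin H₂.r → Bool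
  aG (inj₁ x) (inj₁ y) = adj H₁.graph x y
  aG (inj₁ x) (inj₂ w) = attached H₁.⌞ x ⌟ w
  aG (inj₂ w) (inj₁ x) = attached H₁.⌞ x ⌟ w
  aG (inj₂ v) (inj₂ w) = H₂.outerAdj v w

  aG-sym : ∀ X Y → aG X Y ≡ aG Y X
  aG-sym (inj₁ x) (inj₁ y) = adj-sym H₁.graph x y
  aG-sym (inj₁ x) (inj₂ w) = refl
  aG-sym (inj₂ w) (inj₁ x) = refl
  aG-sym (inj₂ v) (inj₂ w) = H₂.outerAdj-sym v w

  aG-irr : ∀ X → aG X X ≡ false
  aG-irr (inj₁ x) = adj-irr H₁.graph x
  aG-irr (inj₂ v) = H₂.outerAdj-irr v

  module S = SumGraph (k + H₁.r) H₂.r aG aG-sym aG-irr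

  G : Graph
  G = S.graph

  f₁ : Vertex H₁.graph → Vertex G
  f₁ x = S.⌜ inj₁ x ⌝

  embed₂ : Fin k ⊎ Fin H₂.r → Vertex G
  embed₂ (inj₁ i) = f₁ (H₁.clique (π i))
  embed₂ (inj₂ w) = S.⌜ inj₂ w ⌝

  f₂ : Vertex H₂.graph → Vertex G
  f₂ y = embed₂ H₂.⌞ y ⌟

  f₂-⌜⌝ : ∀ Y → f₂ H₂.⌜ Y ⌝ ≡ embed₂ Y
  f₂-⌜⌝ Y = cong embed₂ (H₂.⌞⌜⌝⌟ Y)

  C₁ : Fin k → Vertex H₁.graph
  C₁ = H₁.clique

  C₂ : Fin k → Vertex H₂.graph
  C₂ i = H₂.clique (π i)

  f₂-clique : ∀ i → f₂ (H₂.clique i) ≡ f₁ (C₁ (π i))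
  f₂-clique i = f₂-⌜⌝ (inj₁ i)

  glued : ∀ i → f₁ (C₁ i) ≡ f₂ (C₂ i)
  glued i = sym (trans (f₂-clique (π i)) (cong (f₁ ∘ C₁) (π-invol i)))

  adj-embed₂ : ∀ Y Y′ → adj G (embed₂ Y) (embed₂ Y′) ≡ H₂.adjacent Y Y′
  adj-embed₂ (inj₁ i) (inj₁ j) =
    trans (S.adj-⌜⌝ (inj₁ (C₁ (π i))) (inj₁ (C₁ (π j))))
      (trans (H₁.adj-⌜⌝ (inj₁ (π i)) (inj₁ (π j))) (cong not (==-π i j)))
  adj-embed₂ (inj₁ i) (inj₂ w) =
    trans (S.adj-⌜⌝ (inj₁ (C₁ (π i))) (inj₂ w))
      (trans (cong (λ X → attached X w) (H₁.⌞⌜⌝⌟ (inj₁ (π i)))) (cong (_== H₂.anchor w) (π-invol i)))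
  adj-embed₂ (inj₂ w) (inj₁ i) =
    trans (S.adj-⌜⌝ (inj₂ w) (inj₁ (C₁ (π i))))
      (trans (cong (λ X → attached X w) (H₁.⌞⌜⌝⌟ (inj₁ (π i)))) (cong (_== H₂.anchor w) (π-invol i)))
  adj-embed₂ (inj₂ v) (inj₂ w) = S.adj-⌜⌝ (inj₂ v) (inj₂ w)

  adj-f₂ : ∀ b b′ → adj G (f₂ b) (f₂ b′) ≡ adj H₂.graph b b′
  adj-f₂ b b′ with H₂.decode b | H₂.decode b′
  ... | H₂.⌜ Y ⌝ᵈ | H₂.⌜ Y′ ⌝ᵈ =
    trans (cong₂ (adj G) (f₂-⌜⌝ Y) (f₂-⌜⌝ Y′)) (trans (adj-embed₂ Y Y′) (sym (H₂.adj-⌜⌝ Y Y′)))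

  SideEdge : Vertex G → Vertex G → Set
  SideEdge z w = (∃ λ a → ∃ λ a′ → f₁ a ≡ z × f₁ a′ ≡ w × adj H₁.graph a a′ ≡ true)
               ⊎ (∃ λ b → ∃ λ b′ → f₂ b ≡ z × f₂ b′ ≡ w × adj H₂.graph b b′ ≡ true)

  private
    attached-edge : ∀ x w → attached H₁.⌞ x ⌟ w ≡ true →
                    ∃ λ i → x ≡ C₁ i × adj H₂.graph (C₂ i) (H₂.outer w) ≡ true
    attached-edge x w e with H₁.decode x
    ... | H₁.⌜ inj₁ i ⌝ᵈ = i , refl , H₂.edge
                                        (trans (sym (cong (λ X → attached X w) (H₁.⌞⌜⌝⌟ (inj₁ i)))) e)
    ... | H₁.⌜ inj₂ v ⌝ᵈ with trans (sym (cong (λ X → attached X w) (H₁.⌞⌜⌝⌟ (inj₂ v)))) e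
    ...   | ()

    f₂-C₂ : ∀ i → f₂ (C₂ i) ≡ f₁ (C₁ i)
    f₂-C₂ i = sym (glued i)

  edges-to : ∀ z w → adj G z w ≡ true → SideEdge z w
  edges-to z w e with S.decode z | S.decode w
  ... | S.⌜ inj₁ x ⌝ᵈ | S.⌜ inj₁ y ⌝ᵈ = inj₁ (x , y , refl , refl , S.edge⁻ e)
  ... | S.⌜ inj₂ v ⌝ᵈ | S.⌜ inj₂ u ⌝ᵈ =
    inj₂ (H₂.outer v , H₂.outer u , f₂-⌜⌝ (inj₂ v) , f₂-⌜⌝ (inj₂ u) , H₂.edge (S.edge⁻ e))
  ... | S.⌜ inj₁ x ⌝ᵈ | S.⌜ inj₂ u ⌝ᵈ with attached-edge x u (S.edge⁻ e)
  ...   | i , refl , e₂ = inj₂ (C₂ i , H₂.outer u , f₂-C₂ i , f₂-⌜⌝ (inj₂ u) , e₂)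
  edges-to z w e | S.⌜ inj₂ v ⌝ᵈ | S.⌜ inj₁ y ⌝ᵈ with attached-edge y v (S.edge⁻ e)
  ...   | i , refl , e₂ = inj₂ (H₂.outer v , C₂ i , f₂-⌜⌝ (inj₂ v) , f₂-C₂ i , adj-flip H₂.graph e₂)

  edges-from : ∀ z w → SideEdge z w → adj G z w ≡ true
  edges-from _ _ (inj₁ (a , a′ , refl , refl , e)) = S.edge e
  edges-from _ _ (inj₂ (b , b′ , refl , refl , e)) = trans (adj-f₂ b b′) e

  glue-to : ∀ a b → f₁ a ≡ f₂ b → ∃ λ i → a ≡ C₁ i × b ≡ C₂ i
  glue-to a b eq with H₂.decode b
  ... | H₂.⌜ inj₁ j ⌝ᵈ = π j , inj₁-injective (S.⌜⌝-injective (trans eq (f₂-clique j))) ,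
                          cong H₂.clique (sym (π-invol j))
  ... | H₂.⌜ inj₂ w ⌝ᵈ with S.⌜⌝-injective (trans eq (f₂-⌜⌝ (inj₂ w)))
  ...   | ()

  glue-from : ∀ a b → (∃ λ i → a ≡ C₁ i × b ≡ C₂ i) → f₁ a ≡ f₂ b
  glue-from _ _ (i , refl , refl) = glued i

  cover : ∀ z → (∃ λ a → f₁ a ≡ z) ⊎ (∃ λ b → f₂ b ≡ z)
  cover z with S.decode z
  ... | S.⌜ inj₁ x ⌝ᵈ = inj₁ (x , refl)
  ... | S.⌜ inj₂ w ⌝ᵈ = inj₂ (H₂.outer w , f₂-⌜⌝ (inj₂ w))

  f₁-injective : ∀ a a′ → f₁ a ≡ f₁ a′ → a ≡ a′
  f₁-injective a a′ eq = inj₁-injective (S.⌜⌝-injective eq)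

  embed₂-injective : ∀ Y Y′ → embed₂ Y ≡ embed₂ Y′ → Y ≡ Y′
  embed₂-injective (inj₁ i) (inj₁ j) eq =
    cong inj₁ (π-injective i j (H₁.clique-injective (π i) (π j) (f₁-injective _ _ eq)))
  embed₂-injective (inj₁ i) (inj₂ w) eq with S.⌜⌝-injective eq
  ... | ()
  embed₂-injective (inj₂ v) (inj₁ j) eq with S.⌜⌝-injective eq
  ... | ()
  embed₂-injective (inj₂ v) (inj₂ w) eq = cong inj₂ (inj₂-injective (S.⌜⌝-injective eq))

  f₂-injective : ∀ b b′ → f₂ b ≡ f₂ b′ → b ≡ b′
  f₂-injective b b′ eq with H₂.decode b | H₂.decode b′
  ... | H₂.⌜ Y ⌝ᵈ | H₂.⌜ Y′ ⌝ᵈ =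
    cong H₂.⌜_⌝ (embed₂-injective Y Y′ (trans (sym (f₂-⌜⌝ Y)) (trans eq (f₂-⌜⌝ Y′))))

  cliqueSum : IsCliqueSum k H₁.graph H₂.graph G
  cliqueSum = record
    { C₁ = C₁ ; C₂ = C₂
    ; C₁-inj = H₁.clique-injective
    ; C₂-inj = λ i j eq → π-injective i j (H₂.clique-injective (π i) (π j) eq)
    ; C₁-cl  = λ i j → H₁.clique-adj
    ; C₂-cl  = λ i j i≢j → H₂.clique-adj (λ eq → i≢j (π-injective i j eq))
    ; f₁ = f₁ ; f₂ = f₂
    ; f₁-inj = f₁-injective
    ; f₂-inj = f₂-injective
    ; cover  = cover
    ; glue   = λ a b → mk⇔ (glue-to a b) (glue-from a b)
    ; edges  = λ z w → mk⇔ (edges-to z w) (edges-from z w)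
    }

  open Cross cliqueSum

  outer₁∉C : ∀ v → ¬ S₁.InC (H₁.outer v)
  outer₁∉C v (i , eq) = H₁.outer≢clique eq

  outer₂∉C : ∀ w → ¬ S₂.InC (H₂.outer w)
  outer₂∉C w (i , eq) = H₂.outer≢clique eq

  anchor₂-unique : ∀ {w l} → adj H₂.graph (H₂.outer w) (C₂ l) ≡ true → l ≡ π (H₂.anchor w)
  anchor₂-unique {w} {l} e = trans (sym (π-invol l)) (cong π (H₂.anchor-unique e))

  N : Subset (n G)
  N = image f₁ H₁.outers ∪ image f₂ H₂.outers

  ∣N∣ : ∣ N ∣ ≡ H₁.r + H₂.r
  ∣N∣ = ≤-antisym (≤-trans (∣images∣≤ H₁.outers H₂.outers) (≤-reflexive (cong₂ _+_ H₁.∣outers∣ H₂.∣outers∣)))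
                  (≤-trans (≤-reflexive (cong₂ _+_ (sym H₁.∣outers∣) (sym H₂.∣outers∣)))
                           (∣images∣≥ outers∉C))
    where
      open Bounds cliqueSum using (∣images∣≤; ∣images∣≥)
      outers∉C : ∀ {x} → x ∈ H₁.outers → ¬ S₁.InC x
      outers∉C x∈ with ∈-image⁻ H₁.outer x∈
      ... | v , _ , refl = outer₁∉C v

  f₁-outer∈N : ∀ v → f₁ (H₁.outer v) ∈ N
  f₁-outer∈N v = x∈p∪q⁺ (inj₁ (∈-image⁺ f₁ (∈-image⁺ H₁.outer ∈⊤)))

  f₂-outer∈N : ∀ w → f₂ (H₂.outer w) ∈ N
  f₂-outer∈N w = x∈p∪q⁺ (inj₂ (∈-image⁺ f₂ (∈-image⁺ H₂.outer ∈⊤)))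

  monitored-anchor : ∀ v w → π (H₂.anchor w) ≡ H₁.anchor v →
                     MonitoredBy G N (f₁ (H₁.outer v)) (f₁ (C₁ (H₁.anchor v))) ×
                     MonitoredBy G N (f₁ (C₁ (H₁.anchor v))) (f₂ (H₂.outer w))
  monitored-anchor v w πw≡v =
    let first , second = monitors-through-clique (outer₁∉C v) (outer₂∉C w) (H₁.anchor-adj v) w-adj
                           (λ l e → H₁.anchor-unique e)
    in (_ , _ , f₁-outer∈N v , f₂-outer∈N w , first) , (_ , _ , f₁-outer∈N v , f₂-outer∈N w , second)
    where
      w-adj : adj H₂.graph (H₂.outer w) (C₂ (H₁.anchor v)) ≡ true
      w-adj = subst (λ i → adj H₂.graph (H₂.outer w) (H₂.clique i) ≡ true)
                (trans (sym (π-invol (H₂.anchor w))) (cong π πw≡v)) (H₂.anchor-adj w)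

  monitored-clique-edge : ∀ v w {j} → H₁.anchor v ≢ j → π (H₂.anchor w) ≡ j →
                          (∀ v′ → H₁.outerAdj v v′ ≡ true → H₁.anchor v′ ≢ j) →
                          (∀ w′ → H₂.outerAdj w w′ ≡ true → π (H₂.anchor w′) ≢ H₁.anchor v) →
                          MonitoredBy G N (f₁ (C₁ (H₁.anchor v))) (f₁ (C₁ j))
  monitored-clique-edge v w {j} v≢j πw≡j v-far w-far =
    _ , _ , f₁-outer∈N v , f₂-outer∈N w ,
    monitors-clique-edge (outer₁∉C v) (outer₂∉C w) v≢j (H₁.anchor-adj v) w-adj
      (λ l e → H₁.anchor-unique e) (λ l e → trans (anchor₂-unique e) πw≡j) x-far y-far
    where
      w-adj : adj H₂.graph (H₂.outer w) (C₂ j) ≡ true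
      w-adj = subst (λ i → adj H₂.graph (H₂.outer w) (H₂.clique i) ≡ true)
                (trans (sym (π-invol (H₂.anchor w))) (cong π πw≡j)) (H₂.anchor-adj w)
      x-far : ∀ x′ → adj H₁.graph (H₁.outer v) x′ ≡ true → ¬ S₁.InC x′ → adj H₁.graph x′ (C₁ j) ≢ true
      x-far x′ e x′∉C e′ with H₁.outer-neighbour e (λ i eq → x′∉C (i , eq))
      ... | v′ , refl , vv′ = v-far v′ vv′ (sym (H₁.anchor-unique e′))
      y-far : ∀ y′ → adj H₂.graph (H₂.outer w) y′ ≡ true → ¬ S₂.InC y′ → adj H₂.graph y′ (C₂ (H₁.anchor v)) ≢ true
      y-far y′ e y′∉C e′ with H₂.outer-neighbour e (λ i eq → y′∉C (π i , trans eq (cong H₂.clique (sym (π-invol i)))))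
      ... | w′ , refl , ww′ = w-far w′ ww′ (sym (anchor₂-unique e′))

  outers-MEG : (∀ i → ∃ λ v → H₁.anchor v ≡ i) → (∀ i → ∃ λ w → H₂.anchor w ≡ i) →
               (∀ i j → i ≢ j → MonitoredBy G N (f₁ (C₁ i)) (f₁ (C₁ j))) → IsMEGSet G N
  outers-MEG anchored₁ anchored₂ clique-edges z w e with edges-to z w e
  ... | inj₁ (a , a′ , refl , refl , e₁) = side₁ a a′ e₁
    where
      outer-clique : ∀ v → MonitoredBy G N (f₁ (H₁.outer v)) (f₁ (C₁ (H₁.anchor v)))
      outer-clique v = let w , w≡ = anchored₂ (π (H₁.anchor v)) in
        proj₁ (monitored-anchor v w (trans (cong π w≡) (π-invol _)))
      side₁ : ∀ a a′ → adj H₁.graph a a′ ≡ true → MonitoredBy G N (f₁ a) (f₁ a′)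
      side₁ a a′ e₁ with H₁.decode a | H₁.decode a′
      ... | H₁.⌜ inj₁ i ⌝ᵈ | H₁.⌜ inj₁ j ⌝ᵈ = clique-edges i j (H₁.clique-adj⁻ e₁)
      ... | H₁.⌜ inj₂ v ⌝ᵈ | H₁.⌜ inj₁ i ⌝ᵈ with H₁.anchor-unique e₁
      ...   | refl = outer-clique v
      side₁ a a′ e₁ | H₁.⌜ inj₁ i ⌝ᵈ | H₁.⌜ inj₂ v ⌝ᵈ with H₁.anchor-unique (adj-flip H₁.graph e₁)
      ...   | refl = MonitoredBy-swap (outer-clique v)
      side₁ a a′ e₁ | H₁.⌜ inj₂ v ⌝ᵈ | H₁.⌜ inj₂ v′ ⌝ᵈ =
        _ , _ , f₁-outer∈N v , f₁-outer∈N v′ , adjacent-monitors (S₁.map-adj e₁)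
  ... | inj₂ (b , b′ , refl , refl , e₂) = side₂ b b′ e₂
    where
      clique-outer : ∀ w → MonitoredBy G N (f₂ (H₂.clique (H₂.anchor w))) (f₂ (H₂.outer w))
      clique-outer w with anchored₁ (π (H₂.anchor w))
      ... | v , v≡ = subst (λ c → MonitoredBy G N c (f₂ (H₂.outer w)))
                       (trans (cong (f₁ ∘ C₁) v≡) (sym (f₂-clique (H₂.anchor w))))
                       (proj₂ (monitored-anchor v w (sym v≡)))
      side₂ : ∀ b b′ → adj H₂.graph b b′ ≡ true → MonitoredBy G N (f₂ b) (f₂ b′)
      side₂ b b′ e₂ with H₂.decode b | H₂.decode b′
      ... | H₂.⌜ inj₁ i ⌝ᵈ | H₂.⌜ inj₁ j ⌝ᵈ =
        subst₂ (MonitoredBy G N) (sym (f₂-clique i)) (sym (f₂-clique j))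
          (clique-edges (π i) (π j) λ eq → H₂.clique-adj⁻ e₂ (π-injective i j eq))
      ... | H₂.⌜ inj₁ i ⌝ᵈ | H₂.⌜ inj₂ w ⌝ᵈ with H₂.anchor-unique (adj-flip H₂.graph e₂)
      ...   | refl = clique-outer w
      side₂ b b′ e₂ | H₂.⌜ inj₂ w ⌝ᵈ | H₂.⌜ inj₁ i ⌝ᵈ with H₂.anchor-unique e₂
      ...   | refl = MonitoredBy-swap (clique-outer w)
      side₂ b b′ e₂ | H₂.⌜ inj₂ w ⌝ᵈ | H₂.⌜ inj₂ w′ ⌝ᵈ =
        _ , _ , f₂-outer∈N w , f₂-outer∈N w′ , adjacent-monitors (S₂.map-adj e₂)

-- Tightness

-- Clique c₀, …, c₍ₜ₊₁₎; outer vertices a, b attached to c₀ and dₘ attached to cₘ₊₁;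
-- a is adjacent to b and to every dₘ.
module LowerExample (t : ℕ) where

  k : ℕ
  k = suc (suc t)

  r : ℕ
  r = suc k

  pattern a    = zero
  pattern b    = suc zero
  pattern d m  = suc (suc m)

  anchor : Fin r → Fin k
  anchor a     = zero
  anchor b     = zero
  anchor (d m) = suc m

  outerAdj : Fin r → Fin r → Bool
  outerAdj a     a       = false
  outerAdj a     (suc _) = true
  outerAdj (suc _) a     = true
  outerAdj (suc _) (suc _) = false

  outerAdj-sym : ∀ v w → outerAdj v w ≡ outerAdj w v
  outerAdj-sym a       a       = refl
  outerAdj-sym a       (suc _) = refl
  outerAdj-sym (suc _) a       = refl
  outerAdj-sym (suc _) (suc _) = refl

  H : CliqueGraph k
  H = record { r = r ; anchor = anchor ; outerAdj = outerAdj ; outerAdj-sym = outerAdj-sym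
             ; outerAdj-irr = λ { a → refl ; (suc _) → refl } }

  open CliqueGraph H using (graph; ⌜_⌝; edge; connected-via; every-vertex-forced; Detoursᵃ; clique)

  H-connected : Connected graph
  H-connected = connected-via (clique zero) to-c₀
    where
      to-c₀ : ∀ X → Walk graph ⌜ X ⌝ (clique zero)
      to-c₀ (inj₁ zero)    = []
      to-c₀ (inj₁ (suc i)) = edge refl ∷ []
      to-c₀ (inj₂ a)       = edge refl ∷ []
      to-c₀ (inj₂ b)       = edge refl ∷ []
      to-c₀ (inj₂ (d m))   = edge refl ∷ to-c₀ (inj₂ a)

  c₀-detours : Detoursᵃ (inj₁ zero) (inj₂ a)
  c₀-detours (inj₁ (suc i)) _ = inj₂ (inj₂ (inj₂ (d i) , (λ ()) , ==-refl (suc i) , refl))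
  c₀-detours (inj₂ a)       _ = inj₁ refl
  c₀-detours (inj₂ b)       _ = inj₂ (inj₁ refl)

  c-detours : ∀ s → Detoursᵃ (inj₁ (suc s)) (inj₁ zero)
  c-detours s (inj₁ zero)    _ = inj₁ refl
  c-detours s (inj₁ (suc i)) _ = inj₂ (inj₁ refl)
  c-detours s (inj₂ (d m))   _ = inj₂ (inj₂ (inj₂ a , (λ ()) , refl , refl))

  a-detours : Detoursᵃ (inj₂ a) (inj₁ zero)
  a-detours (inj₁ zero)  _ = inj₁ refl
  a-detours (inj₂ b)     _ = inj₂ (inj₁ refl)
  a-detours (inj₂ (d m)) _ = inj₂ (inj₂ (inj₁ (suc m) , (λ ()) , ==-refl (suc m) , refl))

  b-detours : Detoursᵃ (inj₂ b) (inj₁ zero)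
  b-detours (inj₁ zero) _ = inj₁ refl
  b-detours (inj₂ a)    _ = inj₂ (inj₁ refl)

  d-detours : ∀ m → Detoursᵃ (inj₂ (d m)) (inj₂ a)
  d-detours m (inj₁ (suc i)) _ = inj₂ (inj₂ (inj₁ zero , (λ ()) , refl , refl))
  d-detours m (inj₂ a)       _ = inj₁ refl

  H-meg : IsMeg graph (k + r)
  H-meg = every-vertex-forced H-connected λ where
    (inj₁ zero)    → inj₂ a , refl , c₀-detours
    (inj₁ (suc s)) → inj₁ zero , refl , c-detours s
    (inj₂ a)       → inj₁ zero , refl , a-detours
    (inj₂ b)       → inj₁ zero , refl , b-detours
    (inj₂ (d m))   → inj₂ a , refl , d-detours m

  swap01 : Fin k → Fin k
  swap01 zero          = suc zero
  swap01 (suc zero)    = zero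
  swap01 (suc (suc i)) = suc (suc i)

  swap01-invol : ∀ i → swap01 (swap01 i) ≡ i
  swap01-invol zero          = refl
  swap01-invol (suc zero)    = refl
  swap01-invol (suc (suc i)) = refl

  open Glue H H swap01 swap01-invol using (G; cliqueSum; N; ∣N∣; outers-MEG; monitored-clique-edge; f₁; C₁)

  rep : Fin k → Fin r
  rep zero    = b
  rep (suc m) = d m

  anchor-rep : ∀ i → anchor (rep i) ≡ i
  anchor-rep zero    = refl
  anchor-rep (suc m) = refl

  rep-neighbour : ∀ i v → outerAdj (rep i) v ≡ true → anchor v ≡ zero
  rep-neighbour zero    a _ = refl
  rep-neighbour (suc m) a _ = refl

  -- The outer neighbours of rep i and of rep (swap01 j) are all anchored at c₀, which differs
  -- from cⱼ when j ≠ 0 and is glued to c₁ ≠ cᵢ (for i ≠ 1) on the other side.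
  clique-edge : ∀ i j → i ≢ j → j ≢ zero → i ≢ suc zero → MonitoredBy G N (f₁ (C₁ i)) (f₁ (C₁ j))
  clique-edge i j i≢j j≢0 i≢1 =
    subst (λ c → MonitoredBy G N (f₁ (C₁ c)) (f₁ (C₁ j))) (anchor-rep i)
      (monitored-clique-edge (rep i) (rep (swap01 j))
        (λ eq → i≢j (trans (sym (anchor-rep i)) eq))
        (trans (cong swap01 (anchor-rep (swap01 j))) (swap01-invol j))
        (λ v′ e eq → j≢0 (trans (sym eq) (rep-neighbour i v′ e)))
        (λ w′ e eq → i≢1 (trans (sym (anchor-rep i)) (trans (sym eq) (cong swap01 (rep-neighbour (swap01 j) w′ e))))))

  clique-edges : ∀ i j → i ≢ j → MonitoredBy G N (f₁ (C₁ i)) (f₁ (C₁ j))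
  clique-edges i zero i≢j = MonitoredBy-swap (clique-edge zero i (λ eq → i≢j (sym eq)) i≢j (λ ()))
  clique-edges (suc zero) j i≢j =
    MonitoredBy-swap (clique-edge j (suc zero) (λ eq → i≢j (sym eq)) (λ ()) (λ eq → i≢j (sym eq)))
  clique-edges zero          (suc j) i≢j = clique-edge zero (suc j) i≢j (λ ()) (λ ())
  clique-edges (suc (suc i)) (suc j) i≢j = clique-edge (suc (suc i)) (suc j) i≢j (λ ()) (λ ())

  G-connected : Connected G
  G-connected = Bounds.connected cliqueSum zero H-connected H-connected

  G-meg : IsMeg G (r + r)
  G-meg = (N , outers-MEG anchored anchored clique-edges , ∣N∣) , λ M meg →
    +-cancelʳ-≤ (2 * k) (r + r) ∣ M ∣
      (≤-trans (≤-reflexive (rearrange k r)) (Bounds.lower-bound cliqueSum G-connected H-meg H-meg meg))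
    where
      anchored : ∀ i → ∃ λ v → anchor v ≡ i
      anchored i = rep i , anchor-rep i
      rearrange : ∀ k r → (r + r) + 2 * k ≡ (k + r) + (k + r)
      rearrange = solve-∀

  tight : ∃[ G₁ ] ∃[ G₂ ] ∃[ G ] ∃[ m₁ ] ∃[ m₂ ] ∃[ m ]
            (Connected G₁ × Connected G₂ × IsCliqueSum k G₁ G₂ G
             × IsMeg G₁ m₁ × IsMeg G₂ m₂ × IsMeg G m × m₁ + m₂ ≡ m + 2 * k)
  tight = graph , graph , G , k + r , k + r , r + r ,
          H-connected , H-connected , cliqueSum , H-meg , H-meg , G-meg , rearrange k r
    where
      rearrange : ∀ k r → (k + r) + (k + r) ≡ (r + r) + 2 * k
      rearrange = solve-∀

module UpperExample (t : ℕ) where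

  k : ℕ
  k = suc (suc t)

  H : CliqueGraph k
  H = record { r = k ; anchor = λ v → v ; outerAdj = λ _ _ → false
             ; outerAdj-sym = λ _ _ → refl ; outerAdj-irr = λ _ → refl }

  open CliqueGraph H

  leaf-neighbour : ∀ v z → adj graph (outer v) z ≡ true → z ≡ clique v
  leaf-neighbour v z e with decode z
  ... | ⌜ inj₁ i ⌝ᵈ = cong clique (anchor-unique e)
  ... | ⌜ inj₂ w ⌝ᵈ with edge⁻ e
  ...   | ()

  H-connected : Connected graph
  H-connected = connected-via (clique zero) to-c₀
    where
      clique-to-c₀ : ∀ i → Walk graph (clique i) (clique zero)
      clique-to-c₀ zero    = []
      clique-to-c₀ (suc i) = clique-adj (λ ()) ∷ []
      to-c₀ : ∀ X → Walk graph ⌜ X ⌝ (clique zero)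
      to-c₀ (inj₁ i) = clique-to-c₀ i
      to-c₀ (inj₂ v) = anchor-adj v ∷ clique-to-c₀ v

  leaves-monitor : ∀ i j → i ≢ j →
                   Monitors graph (outer i) (outer j) (outer i) (clique i) ×
                   Monitors graph (outer i) (outer j) (clique i) (clique j) ×
                   Monitors graph (outer i) (outer j) (clique j) (outer j)
  leaves-monitor i j i≢j =
    monitors-geodesic₃ (λ eq → i≢j (inj₂-injective (⌜⌝-injective eq)))
      (λ e → case edge⁻ e of λ ())
      (λ w e e′ → i≢j (anchor-unique (adj-flip graph (subst (λ c → adj graph c (outer j) ≡ true) (leaf-neighbour i w e) e′))))
      (anchor-adj i) (clique-adj i≢j) (adj-flip graph (anchor-adj j))
      (λ w₁ w₂ e _ e″ → leaf-neighbour i w₁ e , leaf-neighbour j w₂ (adj-flip graph e″))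

  other : Fin k → Fin k
  other zero    = suc zero
  other (suc _) = zero

  other≢ : ∀ v → v ≢ other v
  other≢ zero    ()
  other≢ (suc _) ()

  outer∈outers : ∀ v → outer v ∈ outers
  outer∈outers v = ∈-image⁺ outer ∈⊤

  leaves-MEG : IsMEGSet graph outers
  leaves-MEG x y e with decode x | decode y
  ... | ⌜ inj₁ i ⌝ᵈ | ⌜ inj₁ j ⌝ᵈ = _ , _ , outer∈outers i , outer∈outers j , proj₁ (proj₂ (leaves-monitor i j (clique-adj⁻ e)))
  ... | ⌜ inj₂ v ⌝ᵈ | ⌜ inj₁ i ⌝ᵈ with anchor-unique e
  ...   | refl = _ , _ , outer∈outers v , outer∈outers (other v) , proj₁ (leaves-monitor v (other v) (other≢ v))
  leaves-MEG x y e | ⌜ inj₁ i ⌝ᵈ | ⌜ inj₂ v ⌝ᵈ with anchor-unique (adj-flip graph e)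
  ...   | refl = _ , _ , outer∈outers v , outer∈outers (other v) , monitors-swap (proj₁ (leaves-monitor v (other v) (other≢ v)))
  leaves-MEG x y e | ⌜ inj₂ v ⌝ᵈ | ⌜ inj₂ w ⌝ᵈ with edge⁻ e
  ...   | ()

  H-meg : IsMeg graph k
  H-meg = (outers , leaves-MEG , ∣outers∣) , λ M meg →
    ≤-trans (≤-reflexive (sym ∣outers∣)) (p⊆q⇒∣p∣≤∣q∣ (leaves-forced M meg))
    where
      leaves-forced : ∀ M → IsMEGSet graph M → outers ⊆ M
      leaves-forced M meg x∈ with ∈-image⁻ outer x∈
      ... | v , _ , refl = pendant-forced H-connected (anchor-adj v) (leaf-neighbour v) M meg

  open Glue H H (λ i → i) (λ _ → refl) using (G; cliqueSum; N; ∣N∣; f₁; f₂; outer₁∉C; outer₂∉C)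

  module S₁ = Side cliqueSum
  module S₂ = Side (swap cliqueSum)

  G-connected : Connected G
  G-connected = Bounds.connected cliqueSum zero H-connected H-connected

  G-meg : IsMeg G (k + k)
  G-meg = (N , Bounds.images-MEG cliqueSum leaves-MEG leaves-MEG , ∣N∣) , λ M meg →
    ≤-trans (≤-reflexive (sym ∣N∣)) (p⊆q⇒∣p∣≤∣q∣ (leaves-forced M meg))
    where
      leaves-forced : ∀ M → IsMEGSet G M → N ⊆ M
      leaves-forced M meg z∈ with x∈p∪q⁻ (image f₁ outers) _ z∈
      ... | inj₁ z∈₁ with ∈-image⁻ f₁ z∈₁
      ...   | x , x∈ , refl with ∈-image⁻ outer x∈
      ...     | v , _ , refl = pendant-forced G-connected (S₁.map-adj (anchor-adj v))
                                 (S₁.pendant-image (outer₁∉C v) (leaf-neighbour v)) M meg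
      leaves-forced M meg z∈ | inj₂ z∈₂ with ∈-image⁻ f₂ z∈₂
      ...   | y , y∈ , refl with ∈-image⁻ outer y∈
      ...     | v , _ , refl = pendant-forced G-connected (S₂.map-adj (anchor-adj v))
                                 (S₂.pendant-image (outer₂∉C v) (leaf-neighbour v)) M meg

  tight : ∃[ G₁ ] ∃[ G₂ ] ∃[ G ] ∃[ m₁ ] ∃[ m₂ ] ∃[ m ]
            (Connected G₁ × Connected G₂ × IsCliqueSum k G₁ G₂ G
             × IsMeg G₁ m₁ × IsMeg G₂ m₂ × IsMeg G m × m ≡ m₁ + m₂)
  tight = graph , graph , G , k , k , k + k ,
          H-connected , H-connected , cliqueSum , H-meg , H-meg , G-meg , refl

meg-clique-sum-bounds : ∀ {k G₁ G₂ G m₁ m₂ m} → Fin k → Connected G₁ → Connected G₂ →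
                        IsCliqueSum k G₁ G₂ G → IsMeg G₁ m₁ → IsMeg G₂ m₂ → IsMeg G m →
                        (m₁ + m₂ ≤ m + 2 * k) × (m ≤ m₁ + m₂)
meg-clique-sum-bounds i conn₁ conn₂ cs meg₁ meg₂ meg@((M , M-MEG , refl) , _) =
  lower-bound (connected i conn₁ conn₂) meg₁ meg₂ M-MEG , upper-bound meg₁ meg₂ meg
  where open Bounds cs

mainTheorem7 :
    ((k : ℕ) → 2 ≤ k → (G₁ G₂ G : Graph) → Connected G₁ → Connected G₂ →
      IsCliqueSum k G₁ G₂ G → (m₁ m₂ m : ℕ) → IsMeg G₁ m₁ → IsMeg G₂ m₂ → IsMeg G m →
      (m₁ + m₂ ≤ m + 2 * k) × (m ≤ m₁ + m₂))
    × ((k : ℕ) → 2 ≤ k →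
      (∃[ G₁ ] ∃[ G₂ ] ∃[ G ] ∃[ m₁ ] ∃[ m₂ ] ∃[ m ]
        (Connected G₁ × Connected G₂ × IsCliqueSum k G₁ G₂ G
         × IsMeg G₁ m₁ × IsMeg G₂ m₂ × IsMeg G m × m₁ + m₂ ≡ m + 2 * k))
      × (∃[ G₁ ] ∃[ G₂ ] ∃[ G ] ∃[ m₁ ] ∃[ m₂ ] ∃[ m ]
        (Connected G₁ × Connected G₂ × IsCliqueSum k G₁ G₂ G
         × IsMeg G₁ m₁ × IsMeg G₂ m₂ × IsMeg G m × m ≡ m₁ + m₂)))
mainTheorem7 =
  (λ k 2≤k G₁ G₂ G conn₁ conn₂ cs m₁ m₂ m → meg-clique-sum-bounds (fromℕ< (≤-trans (n≤1+n 1) 2≤k)) conn₁ conn₂ cs)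
  , λ { zero () ; (suc zero) (s≤s ()) ; (suc (suc t)) _ → LowerExample.tight t , UpperExample.tight t }
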